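{- The rational numbers $\beta_n$ ($n\ge3$) defined below satisfy $\beta_3=-1$, $\beta_4=1$, and for every integer $n\ge2$: $$\beta_{2n+1}=-\frac{\beta_{n+1}}{\beta_{2n}},\qquad \beta_{2n+2}=1+(-1)^n-\beta_{2n+1}.$$
   Context: Let $(t_n)_{n\ge0}$ be the Thue–Morse sequence ($t_0=0$, $t_{2n}=t_n$, $t_{2n+1}=1-t_n$) and $f(z)=\sum_{i\ge0}(-1)^{t_i}z^{ -i-1}=z^{ -1}\prod_{k=0}^\infty(1-z^{ -2^k})\in\mathbb{Q}((z^{ -1}))$, with continued fraction $f=[0;a_1,a_2,\dots]$, $a_i\in\mathbb{Q}[z]$, and convergents $P_n/Q_n$ ($P_{ -1}=1,P_0=0,Q_{ -1}=0,Q_0=1$, $P_{n+1}=a_{n+1}P_n+P_{n-1}$, $Q_{n+1}=a_{n+1}Q_n+Q_{n-1}$). Let $\hat P_n=P_n/\rho_n$, $\hat Q_n=Q_n/\rho_n$, where $\rho_n$ is the leading coefficient of $P_n$ (so $\hat P_n$ is monic). One has $\hat P_1/\hat Q_1=1/(z+1)$, $\hat P_2/\hat Q_2=(z-1)/(z^2+1)$, and for each $n\ge2$ there is a rational number $\beta_{n+1}$ such that $\hat Q_{n+1}(z)=(z+(-1)^n)\hat Q_n(z)+\beta_{n+1}\hat Q_{n-1}(z)$ and $\hat P_{n+1}(z)=(z+(-1)^n)\hat P_n(z)+\beta_{n+1}\hat P_{n-1}(z)$; this defines $\beta_n$ for $n\ge3$. -}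

module Defs where

open import Data.Bool using (Bool; true; false; not; if_then_else_)
open import Data.Nat as ℕ using (ℕ; zero; suc; _∸_)
open import Data.Nat.DivMod using (_/_; _%_)
open import Data.Integer as ℤ using (ℤ; +_; -[1+_])
open import Data.Rational as ℚ using (ℚ; 0ℚ; 1ℚ; 1/_; ≢-nonZero)
open import Data.Rational.Properties using (_≟_)
open import Relation.Nullary using (yes; no)
open import Relation.Binary.PropositionalEquality using (_≡_)

-- Thue–Morse sequence: t 0 = false, t (2n) = t n, t (2n+1) = not (t n).
-- tmF is a fuelled version of the recursion t n = [n odd] xor t (n / 2);
-- fuel n is always enough.

tmF : ℕ → ℕ → Bool
tmF zero    n = false
tmF (suc k) n = if ℕ._≡ᵇ_ (n % 2) 1 then not (tmF k (n / 2)) else tmF k (n / 2)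

tm : ℕ → Bool
tm n = tmF n n

signB : Bool → ℚ
signB false = 1ℚ
signB true  = ℚ.- 1ℚ

negOnePow : ℕ → ℚ
negOnePow zero    = 1ℚ
negOnePow (suc n) = ℚ.- negOnePow n

-- Laurent series in z⁻¹ over ℚ (elements of ℚ((z⁻¹))).
-- ⟨ t , c ⟩ denotes  Σ_{i ≥ 0} c i · z^(t - i).

record Laurent : Set where
  constructor ⟨_,_⟩
  field
    top : ℤ
    cf  : ℕ → ℚ
open Laurent public

coeff : Laurent → ℤ → ℚ
coeff x k with top x ℤ.- k
... | + i      = cf x i
... | -[1+ _ ] = 0ℚ

infix 4 _≈L_
_≈L_ : Laurent → Laurent → Set
x ≈L y = ∀ k → coeff x k ≡ coeff y k

infixl 6 _+L_ _-L_
infixl 7 _*L_ _·L_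

_+L_ : Laurent → Laurent → Laurent
x +L y = ⟨ t , (λ i → coeff x (t ℤ.- + i) ℚ.+ coeff y (t ℤ.- + i)) ⟩
  where t = top x ℤ.⊔ top y

-L_ : Laurent → Laurent
-L x = ⟨ top x , (λ i → ℚ.- cf x i) ⟩

_-L_ : Laurent → Laurent → Laurent
x -L y = x +L (-L y)

_·L_ : ℚ → Laurent → Laurent
r ·L x = ⟨ top x , (λ i → r ℚ.* cf x i) ⟩

sumQ : ℕ → (ℕ → ℚ) → ℚ
sumQ zero    h = 0ℚ
sumQ (suc n) h = sumQ n h ℚ.+ h n

_*L_ : Laurent → Laurent → Laurent
x *L y = ⟨ top x ℤ.+ top y , (λ i → sumQ (suc i) (λ j → cf x j ℚ.* cf y (i ∸ j))) ⟩

constL : ℚ → Laurent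
constL r = ⟨ + 0 , (λ { zero → r ; (suc _) → 0ℚ }) ⟩

zeroL oneL zL : Laurent
zeroL = constL 0ℚ
oneL  = constL 1ℚ
zL    = ⟨ + 1 , (λ { zero → 1ℚ ; (suc _) → 0ℚ }) ⟩

IsPoly : Laurent → Set
IsPoly x = ∀ k → k ℤ.< + 0 → coeff x k ≡ 0ℚ

-- leading coefficient of a polynomial ⟨ t , c ⟩: the first nonzero
-- coefficient among c 0, …, c t (coefficients of z^t, …, z^0); 0 for the zero polynomial.
firstNZ : ℕ → (ℕ → ℚ) → ℚ
firstNZ zero    c = c 0
firstNZ (suc n) c with c 0 ≟ 0ℚ
... | yes _ = firstNZ n (λ i → c (suc i))
... | no  _ = c 0

leadCoeff : Laurent → ℚ
leadCoeff x with top x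
... | + d      = firstNZ d (cf x)
... | -[1+ _ ] = 0ℚ

-- total inverse on ℚ (1/r for r ≠ 0; only used on nonzero arguments)
invQ : ℚ → ℚ
invQ r with r ≟ 0ℚ
... | yes _  = 0ℚ
... | no r≢0 = (1/ r) {{≢-nonZero r≢0}}

-- The Thue–Morse Laurent series f = Σ_{i≥0} (-1)^{t_i} z^{-i-1}

fTM : Laurent
fTM = ⟨ -[1+ 0 ] , (λ i → signB (tm i)) ⟩

-- Regular continued fraction expansion g = [a 0; a 1, a 2, …] in ℚ((z⁻¹)):
-- complete quotients x i with x 0 = g, a i = polynomial part of x i,
-- and x (i+1) = 1 / (x i - a i).

record CFExpansion (g : Laurent) : Set where
  field
    a     : ℕ → Laurent
    x     : ℕ → Laurent
    start : x 0 ≈L g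
    poly  : ∀ i → IsPoly (a i)
    frac  : ∀ i k → + 0 ℤ.≤ k → coeff (x i -L a i) k ≡ 0ℚ
    step  : ∀ i → (x i -L a i) *L x (suc i) ≈L oneL
open CFExpansion public

-- convergent recurrences; convM a u v n = (sequence at index n - 1),
-- with value u at index -1 and v at index 0:
-- s (n+1) = a (n+1) * s n + s (n-1)
convM : (ℕ → Laurent) → Laurent → Laurent → ℕ → Laurent
convM a u v zero          = u
convM a u v (suc zero)    = v
convM a u v (suc (suc n)) = a (suc n) *L convM a u v (suc n) +L convM a u v n

module _ {g : Laurent} (c : CFExpansion g) where
  P Q : ℕ → Laurent
  P n = convM (a c) oneL zeroL (suc n)
  Q n = convM (a c) zeroL oneL (suc n)

  ρ : ℕ → ℚ
  ρ n = leadCoeff (P n)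

  P̂ Q̂ : ℕ → Laurent
  P̂ n = invQ (ρ n) ·L P n
  Q̂ n = invQ (ρ n) ·L Q n

  DefinesBeta : (ℕ → ℚ) → Set
  DefinesBeta β = ∀ n → 2 ℕ.≤ n →
      (Q̂ (suc n) ≈L (zL +L constL (negOnePow n)) *L Q̂ n +L β (suc n) ·L Q̂ (n ∸ 1))
    × (P̂ (suc n) ≈L (zL +L constL (negOnePow n)) *L P̂ n +L β (suc n) ·L P̂ (n ∸ 1))
    where open import Data.Product using (_×_)

{-# OPTIONS --safe #-}
module Submission where

-- Write f for the Thue–Morse series.  It satisfies f(z) = (z - 1) f(z²), so
-- substituting z² for z in a convergent P_K / Q_K and multiplying the numerator
-- by z - 1 yields an approximation of f as good as the convergent of index 2K;
-- since such approximations are unique up to a scalar, Q̂_{2K}(z) = Q̂_K(z²).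
-- Computing Q̂_{2n+2} once by two steps of the recurrence from Q̂_{2n} and once
-- by substituting z² in the recurrence for Q̂_{n+1}, and comparing coefficients
-- against the monic Q̂_{2n} and Q̂_{2n-2}, gives both relations; the case n = 1,
-- with Q̂₁ = z + 1 and Q̂₂ = z² + 1 computed directly, gives β₃ and β₄.  Finally
-- β_{2n} ≠ 0, since otherwise the determinant P̂_{2n} Q̂_{2n-1} - P̂_{2n-1} Q̂_{2n}
-- would vanish.

open import Defs
open import Data.Nat using (ℕ; suc; _≤_; _*_; _+_)
open import Data.Product using (_×_; Σ)
open import Data.Rational as ℚ using (ℚ; 1ℚ; NonZero; _÷_)
open import Relation.Binary.PropositionalEquality using (_≡_)

open import Algebra.Bundles using (CommutativeRing)
import Algebra.Solver.Ring.AlmostCommutativeRing as AC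
open import Algebra.Structures using (IsCommutativeRing)
open import Data.Bool using (true; false; not; if_then_else_)
open import Data.Empty using (⊥; ⊥-elim)
open import Data.Integer as ℤ using (ℤ; +_; -[1+_]) renaming (_+_ to _+ᶻ_; _-_ to _-ᶻ_; -_ to -ᶻ_; _≤_ to _≤ᶻ_; _<_ to _<ᶻ_)
import Data.Integer.Properties as ℤP
open import Data.Integer.Tactic.RingSolver using () renaming (solve-∀ to zsolve-∀)
open import Data.Maybe using (Maybe; just; nothing)
import Data.Nat as ℕ
open import Data.Nat using (zero; _<_; z≤n; s≤s)
open import Data.Nat.DivMod using (_/_; _%_; m/n<m; m*n%n≡0; m*n/n≡m; [m+kn]%n≡m%n; +-distrib-/)
import Data.Nat.Properties as ℕP
open import Data.Nat.Tactic.RingSolver using () renaming (solve-∀ to nsolve-∀)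
open import Data.Product using (_,_; proj₁; proj₂)
open import Data.Rational using (0ℚ; 1/_; ≢-nonZero)
import Data.Rational.Properties as ℚP
open import Algebra.Properties.Ring ℚP.+-*-ring using (x∙y⁻¹≈ε⇒x≈y; +-inverseʳ-unique; -‿involutive; -‿distribˡ-*)
open import Data.Rational.Solver using (module +-*-Solver)
open import Data.Sum using (_⊎_; inj₁; inj₂)
open import Level using (0ℓ)
open import Relation.Binary.PropositionalEquality
import Relation.Binary.Reasoning.Setoid as SetoidReasoning
open import Relation.Binary.Structures using (IsEquivalence)
open import Relation.Nullary using (¬_; yes; no)

1≢0 : 1ℚ ≢ 0ℚ
1≢0 ()

invQ-inverseˡ : ∀ r → r ≢ 0ℚ → invQ r ℚ.* r ≡ 1ℚ
invQ-inverseˡ r r≢0 with r ℚP.≟ 0ℚ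
... | yes r≡0 = ⊥-elim (r≢0 r≡0)
... | no r≢0′ = ℚP.*-inverseˡ r {{≢-nonZero r≢0′}}

invQ-inverseʳ : ∀ r → r ≢ 0ℚ → r ℚ.* invQ r ≡ 1ℚ
invQ-inverseʳ r r≢0 = trans (ℚP.*-comm r (invQ r)) (invQ-inverseˡ r r≢0)

*-zero-cancelˡ : ∀ r q → r ≢ 0ℚ → r ℚ.* q ≡ 0ℚ → q ≡ 0ℚ
*-zero-cancelˡ r q r≢0 rq≡0 = begin
  q                         ≡⟨ sym (ℚP.*-identityˡ q) ⟩
  1ℚ ℚ.* q                  ≡⟨ cong (ℚ._* q) (sym (invQ-inverseˡ r r≢0)) ⟩
  (invQ r ℚ.* r) ℚ.* q      ≡⟨ ℚP.*-assoc (invQ r) r q ⟩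
  invQ r ℚ.* (r ℚ.* q)      ≡⟨ cong (invQ r ℚ.*_) rq≡0 ⟩
  invQ r ℚ.* 0ℚ             ≡⟨ ℚP.*-zeroʳ (invQ r) ⟩
  0ℚ ∎
  where open ≡-Reasoning

*-nonzero : ∀ r q → r ≢ 0ℚ → q ≢ 0ℚ → r ℚ.* q ≢ 0ℚ
*-nonzero r q r≢0 q≢0 rq≡0 = q≢0 (*-zero-cancelˡ r q r≢0 rq≡0)

*≡1⇒nonzeroˡ : ∀ r q → r ℚ.* q ≡ 1ℚ → r ≢ 0ℚ
*≡1⇒nonzeroˡ r q rq≡1 r≡0 = 1≢0 (trans (sym rq≡1) (trans (cong (ℚ._* q) r≡0) (ℚP.*-zeroˡ q)))

invQ-unique : ∀ r q → q ℚ.* r ≡ 1ℚ → invQ r ≡ q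
invQ-unique r q qr≡1 = begin
  invQ r                      ≡⟨ sym (ℚP.*-identityʳ (invQ r)) ⟩
  invQ r ℚ.* 1ℚ               ≡⟨ cong (invQ r ℚ.*_) (trans (sym qr≡1) (ℚP.*-comm q r)) ⟩
  invQ r ℚ.* (r ℚ.* q)        ≡⟨ sym (ℚP.*-assoc (invQ r) r q) ⟩
  (invQ r ℚ.* r) ℚ.* q        ≡⟨ cong (ℚ._* q) (invQ-inverseˡ r (*≡1⇒nonzeroˡ r q (trans (ℚP.*-comm r q) qr≡1))) ⟩
  1ℚ ℚ.* q                    ≡⟨ ℚP.*-identityˡ q ⟩
  q ∎
  where open ≡-Reasoning

*-cancelʳ-≢0 : ∀ r {x y} → r ≢ 0ℚ → x ℚ.* r ≡ y ℚ.* r → x ≡ y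
*-cancelʳ-≢0 r {x} {y} r≢0 xr≡yr = begin
  x                        ≡⟨ sym (ℚP.*-identityʳ x) ⟩
  x ℚ.* 1ℚ                 ≡⟨ cong (x ℚ.*_) (sym (invQ-inverseʳ r r≢0)) ⟩
  x ℚ.* (r ℚ.* invQ r)     ≡⟨ sym (ℚP.*-assoc x r (invQ r)) ⟩
  x ℚ.* r ℚ.* invQ r       ≡⟨ cong (ℚ._* invQ r) xr≡yr ⟩
  y ℚ.* r ℚ.* invQ r       ≡⟨ ℚP.*-assoc y r (invQ r) ⟩
  y ℚ.* (r ℚ.* invQ r)     ≡⟨ cong (y ℚ.*_) (invQ-inverseʳ r r≢0) ⟩
  y ℚ.* 1ℚ                 ≡⟨ ℚP.*-identityʳ y ⟩
  y ∎
  where open ≡-Reasoning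

*≡-⇒≡-÷ : ∀ {x y z} (nz : NonZero y) → x ℚ.* y ≡ ℚ.- z → x ≡ ℚ.- ((z ÷ y) {{nz}})
*≡-⇒≡-÷ {x} {y} {z} nz xy≡-z = begin
  x                                ≡⟨ sym (ℚP.*-identityʳ x) ⟩
  x ℚ.* 1ℚ                         ≡⟨ cong (x ℚ.*_) (sym (ℚP.*-inverseʳ y {{nz}})) ⟩
  x ℚ.* (y ℚ.* (1/ y) {{nz}})      ≡⟨ sym (ℚP.*-assoc x y _) ⟩
  x ℚ.* y ℚ.* (1/ y) {{nz}}        ≡⟨ cong (ℚ._* (1/ y) {{nz}}) xy≡-z ⟩
  ℚ.- z ℚ.* (1/ y) {{nz}}          ≡⟨ sym (-‿distribˡ-* z _) ⟩
  ℚ.- ((z ÷ y) {{nz}}) ∎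
  where open ≡-Reasoning

negOnePow-square : ∀ n → negOnePow n ℚ.* negOnePow n ≡ 1ℚ
negOnePow-square zero = refl
negOnePow-square (suc n) = trans (neg*neg (negOnePow n)) (negOnePow-square n)
  where
  neg*neg : ∀ r → ℚ.- r ℚ.* ℚ.- r ≡ r ℚ.* r
  neg*neg = solve 1 (λ r → :- r :* :- r := r :* r) refl
    where open +-*-Solver

negOnePow-nonzero : ∀ n → negOnePow n ≢ 0ℚ
negOnePow-nonzero n = *≡1⇒nonzeroˡ (negOnePow n) (negOnePow n) (negOnePow-square n)

negOnePow-even : ∀ k → negOnePow (k ℕ.+ k) ≡ 1ℚ
negOnePow-even zero = refl
negOnePow-even (suc k) = begin
  negOnePow (suc k ℕ.+ suc k)       ≡⟨ cong (λ i → negOnePow (suc i)) (ℕP.+-suc k k) ⟩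
  ℚ.- ℚ.- negOnePow (k ℕ.+ k)       ≡⟨ -‿involutive (negOnePow (k ℕ.+ k)) ⟩
  negOnePow (k ℕ.+ k)               ≡⟨ negOnePow-even k ⟩
  1ℚ ∎
  where open ≡-Reasoning

≤-offset : ∀ {a b : ℤ} → a ≤ᶻ b → Σ ℕ (λ d → b ≡ a +ᶻ + d)
≤-offset {a} {b} p = ℤ.∣ b -ᶻ a ∣ , eq
  where
  e1 : + ℤ.∣ b -ᶻ a ∣ ≡ b -ᶻ a
  e1 = ℤP.0≤i⇒+∣i∣≡i (ℤP.i≤j⇒0≤j-i p)
  lem : ∀ a b → b ≡ a +ᶻ (b -ᶻ a)
  lem = zsolve-∀
  eq : b ≡ a +ᶻ + ℤ.∣ b -ᶻ a ∣
  eq = trans (lem a b) (cong (λ x → a +ᶻ x) (sym e1))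

offset-≤ : ∀ {a b : ℤ} (d : ℕ) → b ≡ a +ᶻ + d → a ≤ᶻ b
offset-≤ {a} d refl = ℤP.i≤i+j a (+ d)

private
  suc-shift : ∀ a d → (+ 1 +ᶻ a) +ᶻ d ≡ a +ᶻ (+ 1 +ᶻ d)
  suc-shift = zsolve-∀

<-offset : ∀ {a b : ℤ} → a <ᶻ b → Σ ℕ (λ d → b ≡ a +ᶻ + suc d)
<-offset {a} {b} p with ≤-offset (ℤP.i<j⇒suc[i]≤j p)
... | d , eq = d , trans eq (suc-shift a (+ d))

offset-< : ∀ {a b : ℤ} (d : ℕ) → b ≡ a +ᶻ + suc d → a <ᶻ b
offset-< {a} {b} d eq = ℤP.suc[i]≤j⇒i<j (offset-≤ d (trans eq (sym (suc-shift a (+ d)))))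

≤⊎> : ∀ (a b : ℤ) → a ≤ᶻ b ⊎ b <ᶻ a
≤⊎> a b with a ℤ.≤? b
... | yes p = inj₁ p
... | no ¬p = inj₂ (ℤP.≰⇒> ¬p)

<⊎≥ : ∀ (a b : ℤ) → a <ᶻ b ⊎ b ≤ᶻ a
<⊎≥ a b with ≤⊎> b a
... | inj₁ p = inj₂ p
... | inj₂ p = inj₁ p

overshoot : ∀ (a b : ℤ) → Σ ℕ (λ n → b <ᶻ a +ᶻ + n)
overshoot a b with <⊎≥ b a
... | inj₁ p = 0 , subst (b <ᶻ_) (sym (ℤP.+-identityʳ a)) p
... | inj₂ p with ≤-offset p
... | d , eq = suc d , offset-< {b} {a +ᶻ + suc d} 0 (sym (trans (cong (λ x → x +ᶻ + 1) eq) (lem a (+ d))))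
  where lem : ∀ a d → a +ᶻ d +ᶻ + 1 ≡ a +ᶻ (+ 1 +ᶻ d)
        lem = zsolve-∀

sumQ-cong : ∀ n {f g : ℕ → ℚ} → (∀ t → t ℕ.< n → f t ≡ g t) → sumQ n f ≡ sumQ n g
sumQ-cong zero h = refl
sumQ-cong (suc n) h = cong₂ ℚ._+_ (sumQ-cong n (λ t p → h t (ℕP.m<n⇒m<1+n p))) (h n ℕP.≤-refl)

sumQ-zero : ∀ n {f : ℕ → ℚ} → (∀ t → t ℕ.< n → f t ≡ 0ℚ) → sumQ n f ≡ 0ℚ
sumQ-zero zero h = refl
sumQ-zero (suc n) h = trans (cong₂ ℚ._+_ (sumQ-zero n (λ t p → h t (ℕP.m<n⇒m<1+n p))) (h n ℕP.≤-refl)) refl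

sumQ-split : ∀ n m (f : ℕ → ℚ) → sumQ (n ℕ.+ m) f ≡ sumQ n f ℚ.+ sumQ m (λ t → f (n ℕ.+ t))
sumQ-split n zero f = trans (cong (λ k → sumQ k f) (ℕP.+-identityʳ n)) (sym (ℚP.+-identityʳ _))
sumQ-split n (suc m) f = begin
    sumQ (n ℕ.+ suc m) f
  ≡⟨ cong (λ k → sumQ k f) (ℕP.+-suc n m) ⟩
    sumQ (n ℕ.+ m) f ℚ.+ f (n ℕ.+ m)
  ≡⟨ cong (ℚ._+ f (n ℕ.+ m)) (sumQ-split n m f) ⟩
    (sumQ n f ℚ.+ sumQ m (λ t → f (n ℕ.+ t))) ℚ.+ f (n ℕ.+ m)
  ≡⟨ ℚP.+-assoc (sumQ n f) (sumQ m (λ t → f (n ℕ.+ t))) (f (n ℕ.+ m)) ⟩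
    sumQ n f ℚ.+ sumQ (suc m) (λ t → f (n ℕ.+ t)) ∎
  where open ≡-Reasoning

sumQ-+ : ∀ n (f g : ℕ → ℚ) → sumQ n (λ t → f t ℚ.+ g t) ≡ sumQ n f ℚ.+ sumQ n g
sumQ-+ zero f g = refl
sumQ-+ (suc n) f g = trans (cong (ℚ._+ (f n ℚ.+ g n)) (sumQ-+ n f g)) (lem (sumQ n f) (sumQ n g) (f n) (g n))
  where lem : ∀ a b c d → (a ℚ.+ b) ℚ.+ (c ℚ.+ d) ≡ (a ℚ.+ c) ℚ.+ (b ℚ.+ d)
        lem a b c d = trans (ℚP.+-assoc a b (c ℚ.+ d))
            (trans (cong (a ℚ.+_) (trans (sym (ℚP.+-assoc b c d)) (trans (cong (ℚ._+ d) (ℚP.+-comm b c)) (ℚP.+-assoc c b d))))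
            (sym (ℚP.+-assoc a c (b ℚ.+ d))))

sumQ-* : ∀ n (r : ℚ) (f : ℕ → ℚ) → sumQ n (λ t → r ℚ.* f t) ≡ r ℚ.* sumQ n f
sumQ-* zero r f = sym (ℚP.*-zeroʳ r)
sumQ-* (suc n) r f = trans (cong (ℚ._+ (r ℚ.* f n)) (sumQ-* n r f)) (sym (ℚP.*-distribˡ-+ r _ _))

sumQ-swap : ∀ n m (h : ℕ → ℕ → ℚ) → sumQ n (λ i → sumQ m (λ j → h i j)) ≡ sumQ m (λ j → sumQ n (λ i → h i j))
sumQ-swap zero m h = sym (sumQ-zero m (λ _ _ → refl))
sumQ-swap (suc n) m h = trans (cong (ℚ._+ sumQ m (h n)) (sumQ-swap n m h)) (sym (sumQ-+ m (λ j → sumQ n (λ i → h i j)) (h n)))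

Σz : ℤ → ℕ → (ℤ → ℚ) → ℚ
Σz L n h = sumQ n (λ t → h (L +ᶻ + t))

InWindow : ℤ → ℕ → ℤ → Set
InWindow L n j = L ≤ᶻ j × j <ᶻ L +ᶻ + n

OutsideWindow : ℤ → ℕ → ℤ → Set
OutsideWindow L n j = j <ᶻ L ⊎ L +ᶻ + n ≤ᶻ j

InWindow-offset : ∀ L n t → t ℕ.< n → InWindow L n (L +ᶻ + t)
InWindow-offset L n t p = offset-≤ t refl , ℤP.+-monoʳ-< L (ℤ.+<+ p)

Σz-cong : ∀ L n {h g : ℤ → ℚ} → (∀ j → InWindow L n j → h j ≡ g j) → Σz L n h ≡ Σz L n g
Σz-cong L n e = sumQ-cong n (λ t p → e _ (InWindow-offset L n t p))

Σz-zero : ∀ L n {h : ℤ → ℚ} → (∀ j → InWindow L n j → h j ≡ 0ℚ) → Σz L n h ≡ 0ℚ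
Σz-zero L n e = sumQ-zero n (λ t p → e _ (InWindow-offset L n t p))

Σz-split : ∀ L n m h → Σz L (n ℕ.+ m) h ≡ Σz L n h ℚ.+ Σz (L +ᶻ + n) m h
Σz-split L n m h = trans (sumQ-split n m _) (cong (Σz L n h ℚ.+_) (sumQ-cong m (λ t _ → cong h (lem L (+ n) (+ t)))))
  where lem : ∀ a b c → a +ᶻ (b +ᶻ c) ≡ a +ᶻ b +ᶻ c
        lem = zsolve-∀

Σz-shift : ∀ L n c h → Σz L n h ≡ Σz (L +ᶻ c) n (λ j → h (j -ᶻ c))
Σz-shift L n c h = sumQ-cong n (λ t _ → cong h (lem L c (+ t)))
  where lem : ∀ a b c → a +ᶻ c ≡ a +ᶻ b +ᶻ c -ᶻ b
        lem = zsolve-∀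

Σz-+ : ∀ L n (h g : ℤ → ℚ) → Σz L n (λ j → h j ℚ.+ g j) ≡ Σz L n h ℚ.+ Σz L n g
Σz-+ L n h g = sumQ-+ n _ _

Σz-*ˡ : ∀ L n r (h : ℤ → ℚ) → Σz L n (λ j → r ℚ.* h j) ≡ r ℚ.* Σz L n h
Σz-*ˡ L n r h = sumQ-* n r _

Σz-swap : ∀ L n M m (h : ℤ → ℤ → ℚ) → Σz L n (λ i → Σz M m (λ j → h i j)) ≡ Σz M m (λ j → Σz L n (λ i → h i j))
Σz-swap L n M m h = sumQ-swap n m _

Σz-rev : ∀ L n c h → Σz L n (λ j → h (c -ᶻ j)) ≡ Σz (c -ᶻ (L +ᶻ + n) +ᶻ + 1) n h
Σz-rev L zero c h = refl
Σz-rev L (suc n) c h = begin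
    Σz L n (λ j → h (c -ᶻ j)) ℚ.+ h (c -ᶻ (L +ᶻ + n))
  ≡⟨ cong₂ ℚ._+_ (Σz-rev L n c h) (cong h (lem1 c L (+ n))) ⟩
    Σz (c -ᶻ (L +ᶻ + n) +ᶻ + 1) n h ℚ.+ h M
  ≡⟨ ℚP.+-comm (Σz (c -ᶻ (L +ᶻ + n) +ᶻ + 1) n h) (h M) ⟩
    h M ℚ.+ Σz (c -ᶻ (L +ᶻ + n) +ᶻ + 1) n h
  ≡⟨ cong₂ ℚ._+_ (sym (trans (ℚP.+-identityˡ _) (cong h (ℤP.+-identityʳ M)))) (cong (λ x → Σz x n h) (lem2 c L (+ n))) ⟩
    Σz M 1 h ℚ.+ Σz (M +ᶻ + 1) n h
  ≡⟨ sym (Σz-split M 1 n h) ⟩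
    Σz M (suc n) h ∎
  where
  open ≡-Reasoning
  M : ℤ
  M = c -ᶻ (L +ᶻ + suc n) +ᶻ + 1
  lem1 : ∀ c L n → c -ᶻ (L +ᶻ n) ≡ c -ᶻ (L +ᶻ (+ 1 +ᶻ n)) +ᶻ + 1
  lem1 = zsolve-∀
  lem2 : ∀ c L n → c -ᶻ (L +ᶻ n) +ᶻ + 1 ≡ c -ᶻ (L +ᶻ (+ 1 +ᶻ n)) +ᶻ + 1 +ᶻ + 1
  lem2 = zsolve-∀

+ᶻ-cancelˡ : ∀ a {x y} → a +ᶻ x ≡ a +ᶻ y → x ≡ y
+ᶻ-cancelˡ a {x} {y} e = trans (lem a x) (trans (cong (_-ᶻ a) e) (sym (lem a y)))
  where lem : ∀ a x → x ≡ a +ᶻ x -ᶻ a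
        lem = zsolve-∀

Σz-extend : ∀ L n L' n' h → L' ≤ᶻ L → L +ᶻ + n ≤ᶻ L' +ᶻ + n' → (∀ j → OutsideWindow L n j → h j ≡ 0ℚ) → Σz L n h ≡ Σz L' n' h
Σz-extend L n L' n' h p q z with ≤-offset p | ≤-offset q
... | d , refl | e , eq2 = sym (begin
    Σz L' n' h
  ≡⟨ cong (λ k → Σz L' k h) n'eq ⟩
    Σz L' (d ℕ.+ (n ℕ.+ e)) h
  ≡⟨ Σz-split L' d (n ℕ.+ e) h ⟩
    Σz L' d h ℚ.+ Σz (L' +ᶻ + d) (n ℕ.+ e) h
  ≡⟨ cong₂ ℚ._+_ (Σz-zero L' d (λ j r → z j (inj₁ (proj₂ r)))) (Σz-split (L' +ᶻ + d) n e h) ⟩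
    0ℚ ℚ.+ (Σz (L' +ᶻ + d) n h ℚ.+ Σz (L' +ᶻ + d +ᶻ + n) e h)
  ≡⟨ ℚP.+-identityˡ _ ⟩
    Σz (L' +ᶻ + d) n h ℚ.+ Σz (L' +ᶻ + d +ᶻ + n) e h
  ≡⟨ cong (Σz (L' +ᶻ + d) n h ℚ.+_) (Σz-zero (L' +ᶻ + d +ᶻ + n) e (λ j r → z j (inj₂ (proj₁ r)))) ⟩
    Σz (L' +ᶻ + d) n h ℚ.+ 0ℚ
  ≡⟨ ℚP.+-identityʳ _ ⟩
    Σz (L' +ᶻ + d) n h ∎)
  where
  open ≡-Reasoning
  lem : ∀ a d n e → a +ᶻ d +ᶻ n +ᶻ e ≡ a +ᶻ (d +ᶻ (n +ᶻ e))
  lem = zsolve-∀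
  n'eq : n' ≡ d ℕ.+ (n ℕ.+ e)
  n'eq = ℤP.+-injective (+ᶻ-cancelˡ L' (trans eq2 (lem L' (+ d) (+ n) (+ e))))

Σz-support : ∀ L1 n1 L2 n2 h → (∀ j → OutsideWindow L1 n1 j → h j ≡ 0ℚ) → (∀ j → OutsideWindow L2 n2 j → h j ≡ 0ℚ) →
             Σz L1 n1 h ≡ Σz L2 n2 h
Σz-support L1 n1 L2 n2 h z1 z2 with ≤⊎> L1 L2
... | inj₁ p with ≤-offset p
... | d , refl = trans (Σz-extend L1 n1 L1 (n1 ℕ.+ d ℕ.+ n2) h ℤP.≤-refl (offset-≤ (d ℕ.+ n2) (lem1 L1 (+ n1) (+ d) (+ n2))) z1)
                       (sym (Σz-extend (L1 +ᶻ + d) n2 L1 (n1 ℕ.+ d ℕ.+ n2) h p (offset-≤ n1 (lem2 L1 (+ n1) (+ d) (+ n2))) z2))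
  where
  lem1 : ∀ a n1 d n2 → a +ᶻ (n1 +ᶻ d +ᶻ n2) ≡ a +ᶻ n1 +ᶻ (d +ᶻ n2)
  lem1 = zsolve-∀
  lem2 : ∀ a n1 d n2 → a +ᶻ (n1 +ᶻ d +ᶻ n2) ≡ a +ᶻ d +ᶻ n2 +ᶻ n1
  lem2 = zsolve-∀
Σz-support L1 n1 L2 n2 h z1 z2 | inj₂ p with ≤-offset (ℤP.<⇒≤ p)
... | d , refl = trans (Σz-extend (L2 +ᶻ + d) n1 L2 (n2 ℕ.+ d ℕ.+ n1) h (ℤP.<⇒≤ p) (offset-≤ n2 (lem2 L2 (+ n2) (+ d) (+ n1))) z1)
                       (sym (Σz-extend L2 n2 L2 (n2 ℕ.+ d ℕ.+ n1) h ℤP.≤-refl (offset-≤ (d ℕ.+ n1) (lem1 L2 (+ n2) (+ d) (+ n1))) z2))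
  where
  lem1 : ∀ a n1 d n2 → a +ᶻ (n1 +ᶻ d +ᶻ n2) ≡ a +ᶻ n1 +ᶻ (d +ᶻ n2)
  lem1 = zsolve-∀
  lem2 : ∀ a n1 d n2 → a +ᶻ (n1 +ᶻ d +ᶻ n2) ≡ a +ᶻ d +ᶻ n2 +ᶻ n1
  lem2 = zsolve-∀

-- Coefficients of Laurent series

Deg≤ : Laurent → ℤ → Set
Deg≤ x a = ∀ j → a <ᶻ j → coeff x j ≡ 0ℚ

coeff-at : ∀ x k i → top x -ᶻ k ≡ + i → coeff x k ≡ cf x i
coeff-at x k i e with top x -ᶻ k
... | + n = cong (cf x) (ℤP.+-injective e)
... | -[1+ n ] = ⊥-elim (bad e)
  where bad : -[1+ n ] ≡ + i → ⊥
        bad ()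

coeff-above-top : ∀ x k n → top x -ᶻ k ≡ -[1+ n ] → coeff x k ≡ 0ℚ
coeff-above-top x k n e with top x -ᶻ k
... | + i = ⊥-elim (bad e)
  where bad : + i ≡ -[1+ n ] → ⊥
        bad ()
... | -[1+ m ] = refl

Deg≤-top : ∀ x → Deg≤ x (top x)
Deg≤-top x j p with <-offset p
... | d , refl = coeff-above-top x _ d (lem (top x) d)
  where lem : ∀ t d → t -ᶻ (t +ᶻ + suc d) ≡ -[1+ d ]
        lem t d = trans (lem' t (+ suc d)) refl
          where lem' : ∀ t e → t -ᶻ (t +ᶻ e) ≡ -ᶻ e
                lem' = zsolve-∀

coeff-cf : ∀ x i → coeff x (top x -ᶻ + i) ≡ cf x i
coeff-cf x i = coeff-at x _ i (lem (top x) (+ i))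
  where lem : ∀ t i → t -ᶻ (t -ᶻ i) ≡ i
        lem = zsolve-∀

top-split : ∀ (t k : ℤ) → Σ ℕ (λ i → t -ᶻ k ≡ + i × k ≡ t -ᶻ + i) ⊎ t <ᶻ k
top-split t k with ≤⊎> k t
... | inj₂ p = inj₂ p
... | inj₁ p with ≤-offset p
... | i , refl = inj₁ (i , lem k (+ i) , sym (lem2 k (+ i)))
  where lem : ∀ k i → k +ᶻ i -ᶻ k ≡ i
        lem = zsolve-∀
        lem2 : ∀ k i → k +ᶻ i -ᶻ i ≡ k
        lem2 = zsolve-∀

coeff-neg : ∀ x k → coeff (-L x) k ≡ ℚ.- coeff x k
coeff-neg x k with top x -ᶻ k
... | + i = refl
... | -[1+ n ] = refl

coeff-scale : ∀ r x k → coeff (r ·L x) k ≡ r ℚ.* coeff x k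
coeff-scale r x k with top x -ᶻ k
... | + i = refl
... | -[1+ n ] = sym (ℚP.*-zeroʳ r)

Deg≤-mono : ∀ {x a b} → Deg≤ x a → a ≤ᶻ b → Deg≤ x b
Deg≤-mono v p j q = v j (ℤP.≤-<-trans p q)

coeff-add : ∀ x y k → coeff (x +L y) k ≡ coeff x k ℚ.+ coeff y k
coeff-add x y k with top-split (top x ℤ.⊔ top y) k
... | inj₁ (i , e1 , e2) = trans (coeff-at (x +L y) k i e1) (sym (cong₂ (λ a b → coeff x a ℚ.+ coeff y b) e2 e2))
... | inj₂ p = trans (coeff-above-top (x +L y) k _ (proj₂ (<-negOffset p)))
                 (sym (trans (cong₂ ℚ._+_ (Deg≤-top x k (ℤP.≤-<-trans (ℤP.i≤i⊔j (top x) (top y)) p))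
                                          (Deg≤-top y k (ℤP.≤-<-trans (ℤP.i≤j⊔i (top x) (top y)) p))) (ℚP.+-identityˡ 0ℚ)))
  where
  <-negOffset : ∀ {a b} → a <ᶻ b → Σ ℕ (λ d → a -ᶻ b ≡ -[1+ d ])
  <-negOffset {a} p with <-offset p
  ... | d , refl = d , lem a (+ suc d)
    where lem : ∀ t e → t -ᶻ (t +ᶻ e) ≡ -ᶻ e
          lem = zsolve-∀

coeff-sub : ∀ x y k → coeff (x -L y) k ≡ coeff x k ℚ.- coeff y k
coeff-sub x y k = trans (coeff-add x (-L y) k) (cong (coeff x k ℚ.+_) (coeff-neg y k))

Deg≤-const : ∀ r → Deg≤ (constL r) (+ 0)
Deg≤-const r = Deg≤-top (constL r)

coeff-const-off : ∀ r k → k ≢ + 0 → coeff (constL r) k ≡ 0ℚ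
coeff-const-off r k ne with top-split (+ 0) k
... | inj₂ p = Deg≤-top (constL r) k p
... | inj₁ (zero , e1 , e2) = ⊥-elim (ne (trans e2 refl))
... | inj₁ (suc i , e1 , e2) = coeff-at (constL r) k (suc i) e1

Deg≤-z : Deg≤ zL (+ 1)
Deg≤-z = Deg≤-top zL

coeff-z-off : ∀ k → k ≢ + 1 → coeff zL k ≡ 0ℚ
coeff-z-off k ne with top-split (+ 1) k
... | inj₂ p = Deg≤-top zL k p
... | inj₁ (zero , e1 , e2) = ⊥-elim (ne (trans e2 refl))
... | inj₁ (suc i , e1 , e2) = coeff-at zL k (suc i) e1

private
  left-of-window : ∀ {j L k b} → j <ᶻ L → L ≤ᶻ k -ᶻ b → b <ᶻ k -ᶻ j
  left-of-window {j} {L} {k} {b} p q with <-offset p | ≤-offset q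
  ... | d , refl | e , eq = offset-< (d ℕ.+ e) (trans (cong (_-ᶻ j) (lem0 k b (eq))) (lem j b (+ d) (+ e)))
    where
    lem0 : ∀ k b {X} → k -ᶻ b ≡ X → k ≡ X +ᶻ b
    lem0 k b refl = lem00 k b
      where lem00 : ∀ k b → k ≡ k -ᶻ b +ᶻ b
            lem00 = zsolve-∀
    lem : ∀ j b d e → j +ᶻ (+ 1 +ᶻ d) +ᶻ e +ᶻ b -ᶻ j ≡ b +ᶻ (+ 1 +ᶻ (d +ᶻ e))
    lem = zsolve-∀

  term-vanishes : ∀ x y k a b → Deg≤ x a → Deg≤ y b → ∀ j → a <ᶻ j ⊎ b <ᶻ k -ᶻ j → coeff x j ℚ.* coeff y (k -ᶻ j) ≡ 0ℚ
  term-vanishes x y k a b vx vy j (inj₁ p) = trans (cong (ℚ._* coeff y (k -ᶻ j)) (vx j p)) (ℚP.*-zeroˡ (coeff y (k -ᶻ j)))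
  term-vanishes x y k a b vx vy j (inj₂ p) = trans (cong (coeff x j ℚ.*_) (vy (k -ᶻ j) p)) (ℚP.*-zeroʳ (coeff x j))

coeff-mul-window : ∀ x y k a b L n → Deg≤ x a → Deg≤ y b → L ≤ᶻ k -ᶻ b → a <ᶻ L +ᶻ + n →
        coeff (x *L y) k ≡ Σz L n (λ j → coeff x j ℚ.* coeff y (k -ᶻ j))
coeff-mul-window x y k a b L n vx vy pL pn with top-split (top x +ᶻ top y) k
... | inj₂ p = trans (coeff-above-top (x *L y) k _ (proj₂ (neg p)))
    (sym (Σz-zero L n (λ j _ → term-vanishes x y k tx ty (Deg≤-top x) (Deg≤-top y) j (cs j))))
  where
  tx ty : ℤ
  tx = top x
  ty = top y
  neg : ∀ {a b} → a <ᶻ b → Σ ℕ (λ d → a -ᶻ b ≡ -[1+ d ])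
  neg {a} p with <-offset p
  ... | d , refl = d , lem a (+ suc d)
    where lem : ∀ t e → t -ᶻ (t +ᶻ e) ≡ -ᶻ e
          lem = zsolve-∀
  cs : ∀ j → tx <ᶻ j ⊎ ty <ᶻ k -ᶻ j
  cs j with ≤⊎> j tx
  ... | inj₂ q = inj₁ q
  ... | inj₁ q with ≤-offset q | <-offset p
  ... | d , refl | e , eq = inj₂ (offset-< (d ℕ.+ e) (trans (cong (_-ᶻ j) eq) (lem j (+ d) ty (+ e))))
    where lem : ∀ j d ty e → j +ᶻ d +ᶻ ty +ᶻ (+ 1 +ᶻ e) -ᶻ j ≡ ty +ᶻ (+ 1 +ᶻ (d +ᶻ e))
          lem = zsolve-∀
... | inj₁ (i , e1 , e2) = begin
    coeff (x *L y) k
  ≡⟨ coeff-at (x *L y) k i e1 ⟩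
    sumQ (suc i) (λ t → cf x t ℚ.* cf y (i ℕ.∸ t))
  ≡⟨ sumQ-cong (suc i) stepA ⟩
    Σz (+ 0) (suc i) (λ j → h (tx -ᶻ j))
  ≡⟨ Σz-rev (+ 0) (suc i) tx h ⟩
    Σz (tx -ᶻ (+ 0 +ᶻ + suc i) +ᶻ + 1) (suc i) h
  ≡⟨ Σz-support _ (suc i) L n h z1 z2 ⟩
    Σz L n h ∎
  where
  open ≡-Reasoning
  tx ty : ℤ
  tx = top x
  ty = top y
  h : ℤ → ℚ
  h j = coeff x j ℚ.* coeff y (k -ᶻ j)
  stepA : ∀ t → t ℕ.< suc i → cf x t ℚ.* cf y (i ℕ.∸ t) ≡ h (tx -ᶻ (+ 0 +ᶻ + t))
  stepA t p = sym (cong₂ ℚ._*_ (coeff-cf x t) (coeff-at y _ (i ℕ.∸ t) eq))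
    where
    ii : + i ≡ + t +ᶻ + (i ℕ.∸ t)
    ii = cong +_ (sym (ℕP.m+[n∸m]≡n (ℕP.≤-pred p)))
    lem : ∀ tx ty i t → ty -ᶻ (tx +ᶻ ty -ᶻ i -ᶻ (tx -ᶻ t)) ≡ i -ᶻ t
    lem = zsolve-∀
    lem2 : ∀ t u → t +ᶻ u -ᶻ t ≡ u
    lem2 = zsolve-∀
    eq : ty -ᶻ (k -ᶻ (tx -ᶻ (+ 0 +ᶻ + t))) ≡ + (i ℕ.∸ t)
    eq = trans (cong (λ k' → ty -ᶻ (k' -ᶻ (tx -ᶻ + t))) e2)
          (trans (lem tx ty (+ i) (+ t)) (trans (cong (_-ᶻ + t) ii) (lem2 (+ t) (+ (i ℕ.∸ t)))))
  M : ℤ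
  M = tx -ᶻ (+ 0 +ᶻ + suc i) +ᶻ + 1
  Meq : M ≡ k -ᶻ ty
  Meq = trans (lem tx (+ i)) (sym (trans (cong (_-ᶻ ty) e2) (lem' tx ty (+ i))))
    where lem : ∀ tx i → tx -ᶻ (+ 0 +ᶻ (+ 1 +ᶻ i)) +ᶻ + 1 ≡ tx -ᶻ i
          lem = zsolve-∀
          lem' : ∀ tx ty i → tx +ᶻ ty -ᶻ i -ᶻ ty ≡ tx -ᶻ i
          lem' = zsolve-∀
  z1 : ∀ j → OutsideWindow M (suc i) j → h j ≡ 0ℚ
  z1 j (inj₁ q) = term-vanishes x y k tx ty (Deg≤-top x) (Deg≤-top y) j (inj₂ (left-of-window {j} {M} {k} {ty} q (ℤP.≤-reflexive Meq)))
  z1 j (inj₂ q) = term-vanishes x y k tx ty (Deg≤-top x) (Deg≤-top y) j (inj₁ (ℤP.<-≤-trans (offset-< 0 (lem tx (+ i))) q))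
    where lem : ∀ tx i → tx -ᶻ (+ 0 +ᶻ (+ 1 +ᶻ i)) +ᶻ + 1 +ᶻ (+ 1 +ᶻ i) ≡ tx +ᶻ (+ 1 +ᶻ + 0)
          lem = zsolve-∀
  z2 : ∀ j → OutsideWindow L n j → h j ≡ 0ℚ
  z2 j (inj₁ q) = term-vanishes x y k a b vx vy j (inj₂ (left-of-window {j} {L} {k} {b} q pL))
  z2 j (inj₂ q) = term-vanishes x y k a b vx vy j (inj₁ (ℤP.<-≤-trans pn q))

window : ℤ → ℤ → ℤ → ℕ
window a b k = proj₁ (overshoot (k -ᶻ b) a)

coeff-mul : ∀ x y k a b → Deg≤ x a → Deg≤ y b → coeff (x *L y) k ≡ Σz (k -ᶻ b) (window a b k) (λ j → coeff x j ℚ.* coeff y (k -ᶻ j))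
coeff-mul x y k a b vx vy = coeff-mul-window x y k a b (k -ᶻ b) (window a b k) vx vy ℤP.≤-refl (proj₂ (overshoot (k -ᶻ b) a))

Deg≤-≈ : ∀ x y a → x ≈L y → Deg≤ x a → Deg≤ y a
Deg≤-≈ x y a e v j p = trans (sym (e j)) (v j p)

-- The ring of Laurent series

≈L-refl : ∀ {x} → x ≈L x
≈L-refl k = refl

≈L-sym : ∀ {x y} → x ≈L y → y ≈L x
≈L-sym e k = sym (e k)

≈L-trans : ∀ {x y z} → x ≈L y → y ≈L z → x ≈L z
≈L-trans e f k = trans (e k) (f k)

+L-cong : ∀ {x x' y y'} → x ≈L x' → y ≈L y' → (x +L y) ≈L (x' +L y')
+L-cong {x} {x'} {y} {y'} e f k = trans (coeff-add x y k) (trans (cong₂ ℚ._+_ (e k) (f k)) (sym (coeff-add x' y' k)))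

negL-cong : ∀ {x x'} → x ≈L x' → (-L x) ≈L (-L x')
negL-cong {x} {x'} e k = trans (coeff-neg x k) (trans (cong ℚ.-_ (e k)) (sym (coeff-neg x' k)))

*L-cong : ∀ {x x' y y'} → x ≈L x' → y ≈L y' → (x *L y) ≈L (x' *L y')
*L-cong {x} {x'} {y} {y'} e f k =
  trans (coeff-mul x y k (top x) (top y) (Deg≤-top x) (Deg≤-top y))
  (trans (Σz-cong (k -ᶻ top y) (window (top x) (top y) k) (λ j _ → cong₂ ℚ._*_ (e j) (f (k -ᶻ j))))
  (sym (coeff-mul x' y' k (top x) (top y) (Deg≤-≈ x x' (top x) e (Deg≤-top x)) (Deg≤-≈ y y' (top y) f (Deg≤-top y)))))

*L-comm : ∀ x y → (x *L y) ≈L (y *L x)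
*L-comm x y k = begin
    coeff (x *L y) k
  ≡⟨ coeff-mul-window x y k tx ty L n (Deg≤-top x) (Deg≤-top y) ℤP.≤-refl pn ⟩
    Σz L n (λ j → coeff x j ℚ.* coeff y (k -ᶻ j))
  ≡⟨ Σz-cong L n (λ j _ → trans (ℚP.*-comm (coeff x j) (coeff y (k -ᶻ j))) (cong (λ i → coeff y (k -ᶻ j) ℚ.* coeff x i) (sym (lem k j)))) ⟩
    Σz L n (λ j → g (k -ᶻ j))
  ≡⟨ Σz-rev L n k g ⟩
    Σz (k -ᶻ (L +ᶻ + n) +ᶻ + 1) n g
  ≡⟨ sym (coeff-mul-window y x k ty tx _ n (Deg≤-top y) (Deg≤-top x) q1 q2) ⟩
    coeff (y *L x) k ∎
  where
  open ≡-Reasoning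
  tx ty : ℤ
  tx = top x
  ty = top y
  L : ℤ
  L = k -ᶻ ty
  n : ℕ
  n = window tx ty k
  pn : tx <ᶻ L +ᶻ + n
  pn = proj₂ (overshoot (k -ᶻ ty) tx)
  g : ℤ → ℚ
  g j = coeff y j ℚ.* coeff x (k -ᶻ j)
  lem : ∀ k j → k -ᶻ (k -ᶻ j) ≡ j
  lem = zsolve-∀
  q1 : k -ᶻ (L +ᶻ + n) +ᶻ + 1 ≤ᶻ k -ᶻ tx
  q1 with <-offset pn
  ... | d , eq = offset-≤ d (trans (lem2 k tx (+ d)) (cong (λ w → k -ᶻ w +ᶻ + 1 +ᶻ + d) (sym eq)))
    where lem2 : ∀ k tx d → k -ᶻ tx ≡ k -ᶻ (tx +ᶻ (+ 1 +ᶻ d)) +ᶻ + 1 +ᶻ d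
          lem2 = zsolve-∀
  q2 : ty <ᶻ k -ᶻ (L +ᶻ + n) +ᶻ + 1 +ᶻ + n
  q2 = offset-< 0 (lem3 k ty (+ n))
    where lem3 : ∀ k ty n → k -ᶻ (k -ᶻ ty +ᶻ n) +ᶻ + 1 +ᶻ n ≡ ty +ᶻ (+ 1 +ᶻ + 0)
          lem3 = zsolve-∀

Σz-*ʳ : ∀ L n (h : ℤ → ℚ) c → Σz L n h ℚ.* c ≡ Σz L n (λ j → h j ℚ.* c)
Σz-*ʳ L n h c = trans (ℚP.*-comm (Σz L n h) c) (trans (sym (Σz-*ˡ L n c h)) (Σz-cong L n (λ j _ → ℚP.*-comm c (h j))))

*L-assoc : ∀ x y z → ((x *L y) *L z) ≈L (x *L (y *L z))
*L-assoc x y z k = begin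
    coeff ((x *L y) *L z) k
  ≡⟨ coeff-mul-window (x *L y) z k (tx +ᶻ ty) tz A N (Deg≤-top (x *L y)) (Deg≤-top z) ℤP.≤-refl q ⟩
    Σz A N (λ j → coeff (x *L y) j ℚ.* coeff z (k -ᶻ j))
  ≡⟨ Σz-cong A N (λ j r → cong (ℚ._* coeff z (k -ᶻ j)) (coeff-mul-window x y j tx ty A' N (Deg≤-top x) (Deg≤-top y) (r1 j r) pN)) ⟩
    Σz A N (λ j → Σz A' N (λ i → coeff x i ℚ.* coeff y (j -ᶻ i)) ℚ.* coeff z (k -ᶻ j))
  ≡⟨ Σz-cong A N (λ j _ → trans (Σz-*ʳ A' N (λ i → coeff x i ℚ.* coeff y (j -ᶻ i)) (coeff z (k -ᶻ j)))
      (Σz-cong A' N (λ i _ → ℚP.*-assoc (coeff x i) (coeff y (j -ᶻ i)) (coeff z (k -ᶻ j))))) ⟩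
    Σz A N (λ j → Σz A' N (λ i → coeff x i ℚ.* (coeff y (j -ᶻ i) ℚ.* coeff z (k -ᶻ j))))
  ≡⟨ Σz-swap A N A' N (λ j i → coeff x i ℚ.* (coeff y (j -ᶻ i) ℚ.* coeff z (k -ᶻ j))) ⟩
    Σz A' N (λ i → Σz A N (λ j → coeff x i ℚ.* (coeff y (j -ᶻ i) ℚ.* coeff z (k -ᶻ j))))
  ≡⟨ Σz-cong A' N (λ i _ → Σz-*ˡ A N (coeff x i) (λ j → coeff y (j -ᶻ i) ℚ.* coeff z (k -ᶻ j))) ⟩
    Σz A' N (λ i → coeff x i ℚ.* Σz A N (λ j → coeff y (j -ᶻ i) ℚ.* coeff z (k -ᶻ j)))
  ≡⟨ Σz-cong A' N (λ i r → cong (coeff x i ℚ.*_) (inner i r)) ⟩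
    Σz A' N (λ i → coeff x i ℚ.* coeff (y *L z) (k -ᶻ i))
  ≡⟨ sym (coeff-mul-window x (y *L z) k tx (ty +ᶻ tz) A' N (Deg≤-top x) (Deg≤-top (y *L z)) (ℤP.≤-reflexive (lemA k ty tz)) pN) ⟩
    coeff (x *L (y *L z)) k ∎
  where
  open ≡-Reasoning
  tx ty tz : ℤ
  tx = top x
  ty = top y
  tz = top z
  A A' : ℤ
  A = k -ᶻ tz
  A' = A -ᶻ ty
  N : ℕ
  N = proj₁ (overshoot A' tx)
  pN : tx <ᶻ A' +ᶻ + N
  pN = proj₂ (overshoot A' tx)
  lemA : ∀ k ty tz → k -ᶻ tz -ᶻ ty ≡ k -ᶻ (ty +ᶻ tz)
  lemA = zsolve-∀
  q : tx +ᶻ ty <ᶻ A +ᶻ + N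
  q with <-offset pN
  ... | d , eq = offset-< d (trans (lem A ty (+ N)) (trans (cong (_+ᶻ ty) eq) (lem2 tx ty (+ d))))
    where lem : ∀ A ty N → A +ᶻ N ≡ A -ᶻ ty +ᶻ N +ᶻ ty
          lem = zsolve-∀
          lem2 : ∀ tx ty d → tx +ᶻ (+ 1 +ᶻ d) +ᶻ ty ≡ tx +ᶻ ty +ᶻ (+ 1 +ᶻ d)
          lem2 = zsolve-∀
  r1 : ∀ j → InWindow A N j → A' ≤ᶻ j -ᶻ ty
  r1 j (p , _) = ℤP.+-monoˡ-≤ (-ᶻ ty) p
  inner : ∀ i → InWindow A' N i → Σz A N (λ j → coeff y (j -ᶻ i) ℚ.* coeff z (k -ᶻ j)) ≡ coeff (y *L z) (k -ᶻ i)
  inner i (_ , p) = begin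
      Σz A N (λ j → coeff y (j -ᶻ i) ℚ.* coeff z (k -ᶻ j))
    ≡⟨ Σz-shift A N (-ᶻ i) (λ j → coeff y (j -ᶻ i) ℚ.* coeff z (k -ᶻ j)) ⟩
      Σz (A +ᶻ -ᶻ i) N (λ j → coeff y (j -ᶻ -ᶻ i -ᶻ i) ℚ.* coeff z (k -ᶻ (j -ᶻ -ᶻ i)))
    ≡⟨ Σz-cong (A +ᶻ -ᶻ i) N (λ j _ → cong₂ (λ a b → coeff y a ℚ.* coeff z b) (l1 j i) (l2 k j i)) ⟩
      Σz (A +ᶻ -ᶻ i) N (λ j → coeff y j ℚ.* coeff z (k -ᶻ i -ᶻ j))
    ≡⟨ sym (coeff-mul-window y z (k -ᶻ i) ty tz (A +ᶻ -ᶻ i) N (Deg≤-top y) (Deg≤-top z) (ℤP.≤-reflexive (l3 k tz i)) q2) ⟩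
      coeff (y *L z) (k -ᶻ i) ∎
    where
    l1 : ∀ j i → j -ᶻ -ᶻ i -ᶻ i ≡ j
    l1 = zsolve-∀
    l2 : ∀ k j i → k -ᶻ (j -ᶻ -ᶻ i) ≡ k -ᶻ i -ᶻ j
    l2 = zsolve-∀
    l3 : ∀ k tz i → k -ᶻ tz +ᶻ -ᶻ i ≡ k -ᶻ i -ᶻ tz
    l3 = zsolve-∀
    q2 : ty <ᶻ A +ᶻ -ᶻ i +ᶻ + N
    q2 with <-offset p
    ... | d , eq = offset-< d (trans (l4 A ty i (+ N)) (trans (cong (λ w → w -ᶻ i +ᶻ ty) eq) (l5 i ty (+ d))))
      where l4 : ∀ A ty i N → A +ᶻ -ᶻ i +ᶻ N ≡ A -ᶻ ty +ᶻ N -ᶻ i +ᶻ ty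
            l4 = zsolve-∀
            l5 : ∀ i ty d → i +ᶻ (+ 1 +ᶻ d) -ᶻ i +ᶻ ty ≡ ty +ᶻ (+ 1 +ᶻ d)
            l5 = zsolve-∀

Σz-singleton : ∀ j h → Σz j 1 h ≡ h j
Σz-singleton j h = trans (ℚP.+-identityˡ _) (cong h (ℤP.+-identityʳ j))

coeff-mul-support : ∀ x y k L n → (∀ j → OutsideWindow L n j → coeff x j ℚ.* coeff y (k -ᶻ j) ≡ 0ℚ) →
         coeff (x *L y) k ≡ Σz L n (λ j → coeff x j ℚ.* coeff y (k -ᶻ j))
coeff-mul-support x y k L n z = trans (coeff-mul x y k (top x) (top y) (Deg≤-top x) (Deg≤-top y))
  (Σz-support (k -ᶻ top y) (window (top x) (top y) k) L n (λ j → coeff x j ℚ.* coeff y (k -ᶻ j)) zc z)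
  where
  zc : ∀ j → OutsideWindow (k -ᶻ top y) (window (top x) (top y) k) j → coeff x j ℚ.* coeff y (k -ᶻ j) ≡ 0ℚ
  zc j (inj₁ q) = trans (cong (coeff x j ℚ.*_) (Deg≤-top y (k -ᶻ j) (lem q))) (ℚP.*-zeroʳ (coeff x j))
    where lem : j <ᶻ k -ᶻ top y → top y <ᶻ k -ᶻ j
          lem q with <-offset q
          ... | d , eq = offset-< d (l k (top y) j (+ d) eq)
            where l : ∀ k ty j d → k -ᶻ ty ≡ j +ᶻ (+ 1 +ᶻ d) → k -ᶻ j ≡ ty +ᶻ (+ 1 +ᶻ d)
                  l k ty j d e = trans (l1 k ty j) (trans (cong (λ w → w -ᶻ j +ᶻ ty) e) (l2 j ty d))
                    where l1 : ∀ k ty j → k -ᶻ j ≡ k -ᶻ ty -ᶻ j +ᶻ ty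
                          l1 = zsolve-∀
                          l2 : ∀ j ty d → j +ᶻ (+ 1 +ᶻ d) -ᶻ j +ᶻ ty ≡ ty +ᶻ (+ 1 +ᶻ d)
                          l2 = zsolve-∀
  zc j (inj₂ q) = trans (cong (ℚ._* coeff y (k -ᶻ j)) (Deg≤-top x j (ℤP.<-≤-trans (proj₂ (overshoot (k -ᶻ top y) (top x))) q)))
      (ℚP.*-zeroˡ (coeff y (k -ᶻ j)))

coeff-zeroL : ∀ k → coeff zeroL k ≡ 0ℚ
coeff-zeroL k with top-split (+ 0) k
... | inj₂ p = Deg≤-top zeroL k p
... | inj₁ (zero , e1 , e2) = coeff-at zeroL k 0 e1
... | inj₁ (suc i , e1 , e2) = coeff-at zeroL k (suc i) e1

coeff-constL-* : ∀ r x k → coeff (constL r *L x) k ≡ r ℚ.* coeff x k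
coeff-constL-* r x k = trans (coeff-mul-support (constL r) x k (+ 0) 1 z)
    (trans (Σz-singleton (+ 0) (λ j → coeff (constL r) j ℚ.* coeff x (k -ᶻ j))) (cong (r ℚ.*_) (cong (coeff x) (ℤP.+-identityʳ k))))
  where
  z : ∀ j → OutsideWindow (+ 0) 1 j → coeff (constL r) j ℚ.* coeff x (k -ᶻ j) ≡ 0ℚ
  z j o = trans (cong (ℚ._* coeff x (k -ᶻ j)) (coeff-const-off r j (ne o))) (ℚP.*-zeroˡ (coeff x (k -ᶻ j)))
    where ne : OutsideWindow (+ 0) 1 j → j ≢ + 0
          ne (inj₁ q) refl = ℤP.<-irrefl refl q
          ne (inj₂ q) refl = ℤP.<-irrefl refl (ℤP.<-≤-trans (ℤ.+<+ (s≤s z≤n)) q)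

coeff-zL-* : ∀ x k → coeff (zL *L x) k ≡ coeff x (k -ᶻ + 1)
coeff-zL-* x k = trans (coeff-mul-support zL x k (+ 1) 1 z)
    (trans (Σz-singleton (+ 1) (λ j → coeff zL j ℚ.* coeff x (k -ᶻ j))) (ℚP.*-identityˡ (coeff x (k -ᶻ + 1))))
  where
  z : ∀ j → OutsideWindow (+ 1) 1 j → coeff zL j ℚ.* coeff x (k -ᶻ j) ≡ 0ℚ
  z j o = trans (cong (ℚ._* coeff x (k -ᶻ j)) (coeff-z-off j (ne o))) (ℚP.*-zeroˡ (coeff x (k -ᶻ j)))
    where ne : OutsideWindow (+ 1) 1 j → j ≢ + 1
          ne (inj₁ q) refl = ℤP.<-irrefl refl q
          ne (inj₂ q) refl = ℤP.<-irrefl refl (ℤP.<-≤-trans (ℤ.+<+ (s≤s (s≤s z≤n))) q)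

*L-distribˡ : ∀ x y z → (x *L (y +L z)) ≈L ((x *L y) +L (x *L z))
*L-distribˡ x y z k = begin
    coeff (x *L (y +L z)) k
  ≡⟨ coeff-mul x (y +L z) k tx b (Deg≤-top x) (Deg≤-top (y +L z)) ⟩
    Σz L n (λ j → coeff x j ℚ.* coeff (y +L z) (k -ᶻ j))
  ≡⟨ Σz-cong L n (λ j _ → trans (cong (coeff x j ℚ.*_) (coeff-add y z (k -ᶻ j)))
      (ℚP.*-distribˡ-+ (coeff x j) (coeff y (k -ᶻ j)) (coeff z (k -ᶻ j)))) ⟩
    Σz L n (λ j → coeff x j ℚ.* coeff y (k -ᶻ j) ℚ.+ coeff x j ℚ.* coeff z (k -ᶻ j))
  ≡⟨ Σz-+ L n (λ j → coeff x j ℚ.* coeff y (k -ᶻ j)) (λ j → coeff x j ℚ.* coeff z (k -ᶻ j)) ⟩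
    Σz L n (λ j → coeff x j ℚ.* coeff y (k -ᶻ j)) ℚ.+ Σz L n (λ j → coeff x j ℚ.* coeff z (k -ᶻ j))
  ≡⟨ cong₂ ℚ._+_ (sym (coeff-mul x y k tx b (Deg≤-top x) (Deg≤-mono {y} (Deg≤-top y) (ℤP.i≤i⊔j (top y) (top z)))))
                  (sym (coeff-mul x z k tx b (Deg≤-top x) (Deg≤-mono {z} (Deg≤-top z) (ℤP.i≤j⊔i (top y) (top z))))) ⟩
    coeff (x *L y) k ℚ.+ coeff (x *L z) k
  ≡⟨ sym (coeff-add (x *L y) (x *L z) k) ⟩
    coeff ((x *L y) +L (x *L z)) k ∎
  where
  open ≡-Reasoning
  tx b L : ℤ
  tx = top x
  b = top y ℤ.⊔ top z
  L = k -ᶻ b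
  n : ℕ
  n = window tx b k

+L-assoc : ∀ x y z → ((x +L y) +L z) ≈L (x +L (y +L z))
+L-assoc x y z k = trans (coeff-add (x +L y) z k) (trans (cong (ℚ._+ coeff z k) (coeff-add x y k))
  (trans (ℚP.+-assoc (coeff x k) (coeff y k) (coeff z k))
      (trans (cong (coeff x k ℚ.+_) (sym (coeff-add y z k))) (sym (coeff-add x (y +L z) k)))))

+L-comm : ∀ x y → (x +L y) ≈L (y +L x)
+L-comm x y k = trans (coeff-add x y k) (trans (ℚP.+-comm (coeff x k) (coeff y k)) (sym (coeff-add y x k)))

+L-identityˡ : ∀ x → (zeroL +L x) ≈L x
+L-identityˡ x k = trans (coeff-add zeroL x k) (trans (cong (ℚ._+ coeff x k) (coeff-zeroL k)) (ℚP.+-identityˡ (coeff x k)))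

+L-identityʳ : ∀ x → (x +L zeroL) ≈L x
+L-identityʳ x = ≈L-trans {x +L zeroL} {zeroL +L x} {x} (+L-comm x zeroL) (+L-identityˡ x)

+L-inverseˡ : ∀ x → ((-L x) +L x) ≈L zeroL
+L-inverseˡ x k = trans (coeff-add (-L x) x k)
    (trans (cong (ℚ._+ coeff x k) (coeff-neg x k)) (trans (ℚP.+-inverseˡ (coeff x k)) (sym (coeff-zeroL k))))

+L-inverseʳ : ∀ x → (x +L (-L x)) ≈L zeroL
+L-inverseʳ x = ≈L-trans {x +L (-L x)} {(-L x) +L x} {zeroL} (+L-comm x (-L x)) (+L-inverseˡ x)

*L-identityˡ : ∀ x → (oneL *L x) ≈L x
*L-identityˡ x k = trans (coeff-constL-* 1ℚ x k) (ℚP.*-identityˡ (coeff x k))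

*L-identityʳ : ∀ x → (x *L oneL) ≈L x
*L-identityʳ x = ≈L-trans {x *L oneL} {oneL *L x} {x} (*L-comm x oneL) (*L-identityˡ x)

*L-distribʳ : ∀ x y z → ((y +L z) *L x) ≈L ((y *L x) +L (z *L x))
*L-distribʳ x y z = ≈L-trans {(y +L z) *L x} {x *L (y +L z)} {(y *L x) +L (z *L x)} (*L-comm (y +L z) x)
  (≈L-trans {x *L (y +L z)} {(x *L y) +L (x *L z)} {(y *L x) +L (z *L x)} (*L-distribˡ x y z)
    (+L-cong {x *L y} {y *L x} {x *L z} {z *L x} (*L-comm x y) (*L-comm x z)))

-- x ≈L y is a function type, from which x and y cannot be inferred; the record
-- wrapper makes them inferable, as the ring solver and setoid reasoning need.
record _≋_ (x y : Laurent) : Set where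
  constructor ⟪_⟫
  field un : x ≈L y

open _≋_ public
infix 4 _≋_

≋-isEquivalence : IsEquivalence _≋_
≋-isEquivalence = record
  { refl = λ {x} → ⟪ ≈L-refl {x} ⟫
  ; sym = λ {x} {y} e → ⟪ ≈L-sym {x} {y} (un e) ⟫
  ; trans = λ {x} {y} {z} e f → ⟪ ≈L-trans {x} {y} {z} (un e) (un f) ⟫
  }

≋-isCommutativeRing : IsCommutativeRing _≋_ _+L_ _*L_ (-L_) zeroL oneL
≋-isCommutativeRing = record
  { isRing = record
    { +-isAbelianGroup = record
      { isGroup = record
        { isMonoid = record
          { isSemigroup = record
            { isMagma = record
              { isEquivalence = ≋-isEquivalence
              ; ∙-cong = λ {x} {x'} {y} {y'} e f → ⟪ +L-cong {x} {x'} {y} {y'} (un e) (un f) ⟫ }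
            ; assoc = λ x y z → ⟪ +L-assoc x y z ⟫ }
          ; identity = (λ x → ⟪ +L-identityˡ x ⟫) , (λ x → ⟪ +L-identityʳ x ⟫) }
        ; inverse = (λ x → ⟪ +L-inverseˡ x ⟫) , (λ x → ⟪ +L-inverseʳ x ⟫)
        ; ⁻¹-cong = λ {x} {y} e → ⟪ negL-cong {x} {y} (un e) ⟫ }
      ; comm = λ x y → ⟪ +L-comm x y ⟫ }
    ; *-cong = λ {x} {x'} {y} {y'} e f → ⟪ *L-cong {x} {x'} {y} {y'} (un e) (un f) ⟫
    ; *-assoc = λ x y z → ⟪ *L-assoc x y z ⟫
    ; *-identity = (λ x → ⟪ *L-identityˡ x ⟫) , (λ x → ⟪ *L-identityʳ x ⟫)
    ; distrib = (λ x y z → ⟪ *L-distribˡ x y z ⟫) , (λ x y z → ⟪ *L-distribʳ x y z ⟫) }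
  ; *-comm = λ x y → ⟪ *L-comm x y ⟫ }

laurentRing : CommutativeRing 0ℓ 0ℓ
laurentRing = record { isCommutativeRing = ≋-isCommutativeRing }

module LR = CommutativeRing laurentRing

module ≋-Reasoning = SetoidReasoning LR.setoid hiding (start)

laurentAlmostRing : AC.AlmostCommutativeRing 0ℓ 0ℓ
laurentAlmostRing = AC.fromCommutativeRing laurentRing

constL-+ : ∀ r s → constL (r ℚ.+ s) ≋ constL r +L constL s
constL-+ r s = ⟪ pointwise ⟫
  where
  pointwise : constL (r ℚ.+ s) ≈L constL r +L constL s
  pointwise k with k ℤ.≟ + 0
  ... | yes refl = sym (coeff-add (constL r) (constL s) (+ 0))
  ... | no ne = trans (coeff-const-off (r ℚ.+ s) k ne)
      (sym (trans (coeff-add (constL r) (constL s) k) (cong₂ ℚ._+_ (coeff-const-off r k ne) (coeff-const-off s k ne))))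

constL-* : ∀ r s → constL (r ℚ.* s) ≋ constL r *L constL s
constL-* r s = ⟪ pointwise ⟫
  where
  pointwise : constL (r ℚ.* s) ≈L constL r *L constL s
  pointwise k with k ℤ.≟ + 0
  ... | yes refl = sym (coeff-constL-* r (constL s) (+ 0))
  ... | no ne = trans (coeff-const-off (r ℚ.* s) k ne)
      (sym (trans (coeff-constL-* r (constL s) k) (trans (cong (r ℚ.*_) (coeff-const-off s k ne)) (ℚP.*-zeroʳ r))))

constL-neg : ∀ r → constL (ℚ.- r) ≋ -L constL r
constL-neg r = ⟪ pointwise ⟫
  where
  pointwise : constL (ℚ.- r) ≈L -L constL r
  pointwise k with k ℤ.≟ + 0
  ... | yes refl = refl
  ... | no ne = trans (coeff-const-off (ℚ.- r) k ne) (sym (trans (coeff-neg (constL r) k) (cong ℚ.-_ (coeff-const-off r k ne))))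

constL-morphism : AC._-Raw-AlmostCommutative⟶_ (CommutativeRing.rawRing ℚP.+-*-commutativeRing) laurentAlmostRing
constL-morphism = record
  { ⟦_⟧ = constL
  ; +-homo = constL-+
  ; *-homo = constL-*
  ; -‿homo = constL-neg
  ; 0-homo = ⟪ (λ k → refl) ⟫
  ; 1-homo = ⟪ (λ k → refl) ⟫ }

constL-≟ : ∀ r s → Maybe (constL r ≋ constL s)
constL-≟ r s with r ℚP.≟ s
... | yes refl = just ⟪ (λ k → refl) ⟫
... | no _ = nothing

open import Algebra.Solver.Ring (CommutativeRing.rawRing ℚP.+-*-commutativeRing) laurentAlmostRing constL-morphism constL-≟
  using (solve; _:=_; _:+_; _:*_; _:-_; :-_; con)

scale≈constL-* : ∀ r x → r ·L x ≋ constL r *L x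
scale≈constL-* r x = ⟪ (λ k → trans (coeff-scale r x k) (sym (coeff-constL-* r x k))) ⟫

constL-sub : ∀ r s → constL (r ℚ.- s) ≋ constL r -L constL s
constL-sub r s = LR.trans (constL-+ r (ℚ.- s)) (LR.+-cong (LR.refl {constL r}) (constL-neg s))

constL-injective : ∀ {r s} → constL r ≋ constL s → r ≡ s
constL-injective e = un e (+ 0)

-- Degrees and polynomials

Deg≤-add : ∀ x y a → Deg≤ x a → Deg≤ y a → Deg≤ (x +L y) a
Deg≤-add x y a vx vy j p = trans (coeff-add x y j) (trans (cong₂ ℚ._+_ (vx j p) (vy j p)) (ℚP.+-identityˡ 0ℚ))

Deg≤-neg : ∀ x a → Deg≤ x a → Deg≤ (-L x) a
Deg≤-neg x a vx j p = trans (coeff-neg x j) (cong ℚ.-_ (vx j p))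

Deg≤-sub : ∀ x y a → Deg≤ x a → Deg≤ y a → Deg≤ (x -L y) a
Deg≤-sub x y a vx vy = Deg≤-add x (-L y) a vx (Deg≤-neg y a vy)

coeff-mul-single : ∀ x y k a b → Deg≤ x a → Deg≤ y b → (∀ j → j <ᶻ a → b <ᶻ k -ᶻ j) →
                   coeff (x *L y) k ≡ coeff x a ℚ.* coeff y (k -ᶻ a)
coeff-mul-single x y k a b vx vy hb = trans (coeff-mul-support x y k a 1 z) (Σz-singleton a (λ j → coeff x j ℚ.* coeff y (k -ᶻ j)))
  where
  z : ∀ j → OutsideWindow a 1 j → coeff x j ℚ.* coeff y (k -ᶻ j) ≡ 0ℚ
  z j (inj₁ q) = trans (cong (coeff x j ℚ.*_) (vy (k -ᶻ j) (hb j q))) (ℚP.*-zeroʳ (coeff x j))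
  z j (inj₂ q) = trans (cong (ℚ._* coeff y (k -ᶻ j)) (vx j (ℤP.<-≤-trans (offset-< 0 refl) q))) (ℚP.*-zeroˡ (coeff y (k -ᶻ j)))

private
  below-window : ∀ a b k → a +ᶻ b ≤ᶻ k → ∀ j → j <ᶻ a → b <ᶻ k -ᶻ j
  below-window a b k p j q with ≤-offset p | <-offset q
  ... | d , refl | e , refl = offset-< (e ℕ.+ d) (lem j (+ e) b (+ d))
    where lem : ∀ j e b d → j +ᶻ (+ 1 +ᶻ e) +ᶻ b +ᶻ d -ᶻ j ≡ b +ᶻ (+ 1 +ᶻ (e +ᶻ d))
          lem = zsolve-∀

coeff-mul-top : ∀ x y a b → Deg≤ x a → Deg≤ y b → coeff (x *L y) (a +ᶻ b) ≡ coeff x a ℚ.* coeff y b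
coeff-mul-top x y a b vx vy = trans (coeff-mul-single x y (a +ᶻ b) a b vx vy (below-window a b (a +ᶻ b) ℤP.≤-refl))
    (cong (λ w → coeff x a ℚ.* coeff y w) (lem a b))
  where lem : ∀ a b → a +ᶻ b -ᶻ a ≡ b
        lem = zsolve-∀

Deg≤-mul : ∀ x y a b → Deg≤ x a → Deg≤ y b → Deg≤ (x *L y) (a +ᶻ b)
Deg≤-mul x y a b vx vy k p = trans (coeff-mul-single x y k a b vx vy (below-window a b k (ℤP.<⇒≤ p)))
    (trans (cong (coeff x a ℚ.*_) (vy (k -ᶻ a) q)) (ℚP.*-zeroʳ (coeff x a)))
  where
  q : b <ᶻ k -ᶻ a
  q with <-offset p
  ... | d , refl = offset-< d (lem a b (+ d))
    where lem : ∀ a b d → a +ᶻ b +ᶻ (+ 1 +ᶻ d) -ᶻ a ≡ b +ᶻ (+ 1 +ᶻ d)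
          lem = zsolve-∀

IsPoly-add : ∀ x y → IsPoly x → IsPoly y → IsPoly (x +L y)
IsPoly-add x y px py k p = trans (coeff-add x y k) (trans (cong₂ ℚ._+_ (px k p) (py k p)) (ℚP.+-identityˡ 0ℚ))

IsPoly-neg : ∀ x → IsPoly x → IsPoly (-L x)
IsPoly-neg x px k p = trans (coeff-neg x k) (cong ℚ.-_ (px k p))

IsPoly-mul : ∀ x y → IsPoly x → IsPoly y → IsPoly (x *L y)
IsPoly-mul x y px py k p = trans (coeff-mul x y k (top x) (top y) (Deg≤-top x) (Deg≤-top y))
    (Σz-zero (k -ᶻ top y) (window (top x) (top y) k) z)
  where
  z : ∀ j → InWindow (k -ᶻ top y) (window (top x) (top y) k) j → coeff x j ℚ.* coeff y (k -ᶻ j) ≡ 0ℚ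
  z j _ with <⊎≥ j (+ 0)
  ... | inj₁ q = trans (cong (ℚ._* coeff y (k -ᶻ j)) (px j q)) (ℚP.*-zeroˡ (coeff y (k -ᶻ j)))
  ... | inj₂ q = trans (cong (coeff x j ℚ.*_) (py (k -ᶻ j) (r q))) (ℚP.*-zeroʳ (coeff x j))
    where r : + 0 ≤ᶻ j → k -ᶻ j <ᶻ + 0
          r q with ≤-offset q | <-offset p
          ... | d , refl | e , eq = offset-< (e ℕ.+ d) (trans eq (lem k (+ d) (+ e)))
            where lem : ∀ k d e → k +ᶻ (+ 1 +ᶻ e) ≡ k -ᶻ (+ 0 +ᶻ d) +ᶻ (+ 1 +ᶻ (e +ᶻ d))
                  lem = zsolve-∀

IsPoly-Deg≤-zero : ∀ x → IsPoly x → Deg≤ x (-[1+ 0 ]) → ∀ k → coeff x k ≡ 0ℚ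
IsPoly-Deg≤-zero x px vx k with <⊎≥ k (+ 0)
... | inj₁ p = px k p
... | inj₂ p = vx k (ℤP.<-≤-trans (ℤ.-<+ {0} {0}) p)

module Quotient (x y w : Laurent) (s t : ℤ) (e : (y *L x) ≈L w) (vy : Deg≤ y s) (nz : coeff y s ≢ 0ℚ) (vw : Deg≤ w t) where

  leading-coeff-zero : ∀ j → t -ᶻ s <ᶻ j → Deg≤ x j → coeff x j ≡ 0ℚ
  leading-coeff-zero j p vx = *-zero-cancelˡ (coeff y s) (coeff x j) nz
      (trans (sym (coeff-mul-top y x s j vy vx)) (trans (e (s +ᶻ j)) (vw (s +ᶻ j) q)))
    where
    q : t <ᶻ s +ᶻ j
    q with <-offset p
    ... | d , refl = offset-< d (lem s t (+ d))
      where lem : ∀ s t d → s +ᶻ (t -ᶻ s +ᶻ (+ 1 +ᶻ d)) ≡ t +ᶻ (+ 1 +ᶻ d)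
            lem = zsolve-∀

  -- Downward induction from top x, the a priori bound on the degree of x.
  coeff-zero-from : ∀ d j → t -ᶻ s <ᶻ j → top x ≤ᶻ j +ᶻ + d → coeff x j ≡ 0ℚ
  coeff-zero-from zero j p q = leading-coeff-zero j p (λ j' r → Deg≤-top x j' (ℤP.≤-<-trans (subst (top x ≤ᶻ_) (ℤP.+-identityʳ j) q) r))
  coeff-zero-from (suc d) j p q = leading-coeff-zero j p (λ j' r → coeff-zero-from d j' (ℤP.<-trans p r) (ℤP.≤-trans q (le r)))
    where le : ∀ {j'} → j <ᶻ j' → j +ᶻ + suc d ≤ᶻ j' +ᶻ + d
          le {j'} r with <-offset r
          ... | f , refl = offset-≤ f (lem j (+ f) (+ d))
            where lem : ∀ j f d → j +ᶻ (+ 1 +ᶻ f) +ᶻ d ≡ j +ᶻ (+ 1 +ᶻ d) +ᶻ f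
                  lem = zsolve-∀

  Deg≤-quotient : Deg≤ x (t -ᶻ s)
  Deg≤-quotient j p = coeff-zero-from (proj₁ (overshoot j (top x))) j p (ℤP.<⇒≤ (proj₂ (overshoot j (top x))))

  coeff-quotient : coeff y s ℚ.* coeff x (t -ᶻ s) ≡ coeff w t
  coeff-quotient = trans (sym (coeff-mul-top y x s (t -ᶻ s) vy Deg≤-quotient)) (trans (e (s +ᶻ (t -ᶻ s))) (cong (coeff w) (lem s t)))
    where lem : ∀ s t → s +ᶻ (t -ᶻ s) ≡ t
          lem = zsolve-∀

firstNZ-spec : ∀ n m (c : ℕ → ℚ) → m ℕ.≤ n → (∀ i → i ℕ.< m → c i ≡ 0ℚ) → c m ≢ 0ℚ → firstNZ n c ≡ c m
firstNZ-spec zero zero c p z nz = refl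
firstNZ-spec (suc n) zero c p z nz with c 0 ℚP.≟ 0ℚ
... | yes e = ⊥-elim (nz e)
... | no _ = refl
firstNZ-spec (suc n) (suc m) c p z nz with c 0 ℚP.≟ 0ℚ
... | yes e = firstNZ-spec n m (λ i → c (suc i)) (ℕP.≤-pred p) (λ i q → z (suc i) (s≤s q)) nz
... | no ne = ⊥-elim (ne (z 0 (s≤s z≤n)))

leadCoeff-spec : ∀ x (d : ℕ) → Deg≤ x (+ d) → coeff x (+ d) ≢ 0ℚ → leadCoeff x ≡ coeff x (+ d)
leadCoeff-spec ⟨ -[1+ n ] , c ⟩ d vx nz = ⊥-elim (nz (Deg≤-top ⟨ -[1+ n ] , c ⟩ (+ d) ℤ.-<+))
leadCoeff-spec ⟨ + t , c ⟩ d vx nz with ℕP.≤-total d t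
... | inj₂ p with ℕP.m≤n⇒m<n∨m≡n p
... | inj₁ q = ⊥-elim (nz (Deg≤-top ⟨ + t , c ⟩ (+ d) (ℤ.+<+ q)))
... | inj₂ refl = trans (firstNZ-spec t 0 c z≤n (λ i ()) (λ e → nz (trans (coeff-at xx (+ t) 0 (ℤP.+-inverseʳ (+ t))) e)))
    (sym (coeff-at xx (+ t) 0 (ℤP.+-inverseʳ (+ t))))
  where xx = ⟨ + t , c ⟩
leadCoeff-spec ⟨ + t , c ⟩ d vx nz | inj₁ p =
  trans (firstNZ-spec t (t ℕ.∸ d) c (ℕP.m∸n≤m t d) z (λ e → nz (trans cm e))) (sym cm)
  where
  xx : Laurent
  xx = ⟨ + t , c ⟩
  tt : + t ≡ + d +ᶻ + (t ℕ.∸ d)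
  tt = cong +_ (sym (ℕP.m+[n∸m]≡n p))
  cm : coeff xx (+ d) ≡ c (t ℕ.∸ d)
  cm = coeff-at xx (+ d) (t ℕ.∸ d) (trans (cong (_-ᶻ + d) tt) (lem (+ d) (+ (t ℕ.∸ d))))
    where lem : ∀ a b → a +ᶻ b -ᶻ a ≡ b
          lem = zsolve-∀
  z : ∀ i → i ℕ.< t ℕ.∸ d → c i ≡ 0ℚ
  z i q = trans (sym (coeff-cf xx i)) (vx (+ t -ᶻ + i) r)
    where r : + d <ᶻ + t -ᶻ + i
          r with <-offset (ℤ.+<+ q)
          ... | f , eq = offset-< f (trans (cong (λ w → w -ᶻ + i) tt) (trans (cong (λ w → + d +ᶻ w -ᶻ + i) eq) (lem (+ d) (+ i) (+ f))))
            where lem : ∀ d i f → d +ᶻ (i +ᶻ (+ 1 +ᶻ f)) -ᶻ i ≡ d +ᶻ (+ 1 +ᶻ f)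
                  lem = zsolve-∀

Deg≤-constL : ∀ r n → Deg≤ (constL r) (+ n)
Deg≤-constL r n = Deg≤-mono {constL r} (Deg≤-const r) (ℤ.+≤+ z≤n)

Deg≤-z+const : ∀ r → Deg≤ (zL +L constL r) (+ 1)
Deg≤-z+const r = Deg≤-add zL (constL r) (+ 1) Deg≤-z (Deg≤-constL r 1)

Deg≤-pred : ∀ x a → Deg≤ x (ℤ.suc a) → coeff x (ℤ.suc a) ≡ 0ℚ → Deg≤ x a
Deg≤-pred x a x-deg top≡0 j a<j with ℤ.suc a ℤ.≟ j
... | yes refl = top≡0
... | no a+1≢j = x-deg j (ℤP.≤∧≢⇒< (ℤP.i<j⇒suc[i]≤j a<j) a+1≢j)

IsPoly-const : ∀ r → IsPoly (constL r)
IsPoly-const r k k<0 = coeff-const-off r k (λ k≡0 → ℤP.<-irrefl k≡0 k<0)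

IsPoly-z : IsPoly zL
IsPoly-z k k<0 = coeff-z-off k (λ { refl → 1≮0 k<0 })
  where
  1≮0 : ¬ (+ 1 <ᶻ + 0)
  1≮0 (ℤ.+<+ ())

Monic : Laurent → ℕ → Set
Monic X d = Deg≤ X (+ d) × coeff X (+ d) ≡ 1ℚ

Monic-≋ : ∀ {X Y} d → X ≋ Y → Monic X d → Monic Y d
Monic-≋ {X} {Y} d X≋Y (X-deg , X-lead) = Deg≤-≈ X Y (+ d) (un X≋Y) X-deg , trans (sym (un X≋Y (+ d))) X-lead

Monic-recurrence : ∀ r s A B d → Monic A d → Deg≤ B (+ d) → Monic ((zL +L constL r) *L A +L constL s *L B) (suc d)
Monic-recurrence r s A B d (A-deg , A-lead) B-deg =
  Deg≤-add ((zL +L constL r) *L A) (constL s *L B) (+ suc d) (Deg≤-mul (zL +L constL r) A (+ 1) (+ d) (Deg≤-z+const r) A-deg)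
    (Deg≤-mono {constL s *L B} (Deg≤-mul (constL s) B (+ 0) (+ d) (Deg≤-const s) B-deg) (ℤ.+≤+ (ℕP.n≤1+n d))) ,
  trans (coeff-add ((zL +L constL r) *L A) (constL s *L B) (+ suc d))
    (cong₂ ℚ._+_ (trans (coeff-mul-top (zL +L constL r) A (+ 1) (+ d) (Deg≤-z+const r) A-deg) (cong (1ℚ ℚ.*_) A-lead))
                 (trans (coeff-constL-* s B (+ suc d)) (trans (cong (s ℚ.*_) (B-deg (+ suc d) (ℤ.+<+ ℕP.≤-refl))) (ℚP.*-zeroʳ s))))

Monic-combination-zero : ∀ {B D : Laurent} {d e : ℕ} (u v : ℚ) → Monic B d → Monic D e → e < d →
                         constL u *L B +L constL v *L D ≋ zeroL → u ≡ 0ℚ × v ≡ 0ℚ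
Monic-combination-zero {B} {D} {d} {e} u v (_ , B-lead) (D-deg , D-lead) e<d combination≋0 = u≡0 , v≡0
  where
  open ≡-Reasoning
  coeff-combination : ∀ k → u ℚ.* coeff B k ℚ.+ v ℚ.* coeff D k ≡ 0ℚ
  coeff-combination k = begin
    u ℚ.* coeff B k ℚ.+ v ℚ.* coeff D k
      ≡⟨ sym (cong₂ ℚ._+_ (coeff-constL-* u B k) (coeff-constL-* v D k)) ⟩
    coeff (constL u *L B) k ℚ.+ coeff (constL v *L D) k
      ≡⟨ sym (coeff-add (constL u *L B) (constL v *L D) k) ⟩
    coeff (constL u *L B +L constL v *L D) k
      ≡⟨ un combination≋0 k ⟩
    coeff zeroL k
      ≡⟨ coeff-zeroL k ⟩
    0ℚ ∎
  u≡0 : u ≡ 0ℚ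
  u≡0 = begin
    u                                     ≡⟨ sym (ℚP.*-identityʳ u) ⟩
    u ℚ.* 1ℚ                              ≡⟨ sym (ℚP.+-identityʳ _) ⟩
    u ℚ.* 1ℚ ℚ.+ 0ℚ                       ≡⟨ cong (u ℚ.* 1ℚ ℚ.+_) (sym (ℚP.*-zeroʳ v)) ⟩
    u ℚ.* 1ℚ ℚ.+ v ℚ.* 0ℚ                 ≡⟨ cong₂ (λ b δ → u ℚ.* b ℚ.+ v ℚ.* δ) (sym B-lead) (sym (D-deg (+ d) (ℤ.+<+ e<d))) ⟩
    u ℚ.* coeff B (+ d) ℚ.+ v ℚ.* coeff D (+ d)   ≡⟨ coeff-combination (+ d) ⟩
    0ℚ ∎
  v≡0 : v ≡ 0ℚ
  v≡0 = begin
    v                                     ≡⟨ sym (ℚP.*-identityʳ v) ⟩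
    v ℚ.* 1ℚ                              ≡⟨ sym (ℚP.+-identityˡ _) ⟩
    0ℚ ℚ.+ v ℚ.* 1ℚ                       ≡⟨ cong (ℚ._+ v ℚ.* 1ℚ) (sym (ℚP.*-zeroˡ (coeff B (+ e)))) ⟩
    0ℚ ℚ.* coeff B (+ e) ℚ.+ v ℚ.* 1ℚ     ≡⟨ cong₂ (λ w δ → w ℚ.* coeff B (+ e) ℚ.+ v ℚ.* δ) (sym u≡0) (sym D-lead) ⟩
    u ℚ.* coeff B (+ e) ℚ.+ v ℚ.* coeff D (+ e)   ≡⟨ coeff-combination (+ e) ⟩
    0ℚ ∎

-- The computation behind both β₃, β₄ and the doubling relations: if B = Q̂_{2n},
-- D = Q̂_{2n-2}, then Q₂ = Q̂_{2n+2} is computed twice, by two steps of the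
-- recurrence from B and by squaring the variable in the recurrence for Q̂_{n+1}.
doubling-relations : ∀ {A B D Q₁ Q₂ : Laurent} {d : ℕ} (b₂ b₃ b₄ bₙ e : ℚ) →
  Monic B (suc (suc d)) → Monic D d →
  B ≋ (zL +L constL (ℚ.- 1ℚ)) *L A +L constL b₂ *L D →
  Q₁ ≋ (zL +L oneL) *L B +L constL b₃ *L A →
  Q₂ ≋ (zL +L constL (ℚ.- 1ℚ)) *L Q₁ +L constL b₄ *L B →
  Q₂ ≋ (zL *L zL +L constL e) *L B +L constL bₙ *L D →
  (b₄ ≡ (1ℚ ℚ.+ e) ℚ.- b₃) × (b₃ ℚ.* b₂ ≡ ℚ.- bₙ)
doubling-relations {A} {B} {D} {Q₁} {Q₂} b₂ b₃ b₄ bₙ e monicB monicD B≋ Q₁≋ Q₂≋ Q₂≋′ =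
  sym (x∙y⁻¹≈ε⇒x≈y _ b₄ (proj₁ u,v≡0)) , +-inverseʳ-unique bₙ _ (proj₂ u,v≡0)
  where
  c₂ c₃ c₄ cₑ cₙ : Laurent
  c₂ = constL b₂
  c₃ = constL b₃
  c₄ = constL b₄
  cₑ = constL e
  cₙ = constL bₙ
  u v : ℚ
  u = ((1ℚ ℚ.+ e) ℚ.- b₃) ℚ.- b₄
  v = bₙ ℚ.+ b₃ ℚ.* b₂
  U≋ : constL u ≋ ((oneL +L cₑ) -L c₃) -L c₄
  U≋ = LR.trans (constL-sub ((1ℚ ℚ.+ e) ℚ.- b₃) b₄)
         (LR.+-cong (LR.trans (constL-sub (1ℚ ℚ.+ e) b₃) (LR.+-cong (constL-+ 1ℚ e) (LR.refl { -L c₃}))) (LR.refl { -L c₄}))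
  V≋ : constL v ≋ cₙ +L c₃ *L c₂
  V≋ = LR.trans (constL-+ bₙ (b₃ ℚ.* b₂)) (LR.+-cong (LR.refl {cₙ}) (constL-* b₃ b₂))
  combination≋0 : constL u *L B +L constL v *L D ≋ zeroL
  combination≋0 = begin
    constL u *L B +L constL v *L D
      ≈⟨ LR.+-cong (LR.*-cong U≋ (LR.refl {B})) (LR.*-cong V≋ (LR.refl {D})) ⟩
    (((oneL +L cₑ) -L c₃) -L c₄) *L B +L (cₙ +L c₃ *L c₂) *L D
      ≈⟨ solve 9 (λ Z A B D c₂ c₃ c₄ cₑ cₙ →
           (((con 1ℚ :+ cₑ) :- c₃) :- c₄) :* B :+ (cₙ :+ c₃ :* c₂) :* D
             := ((Z :* Z :+ cₑ) :* B :+ cₙ :* D) :- ((Z :+ con (ℚ.- 1ℚ)) :* ((Z :+ con 1ℚ) :* B :+ c₃ :* A) :+ c₄ :* B)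
                :+ c₃ :* ((Z :+ con (ℚ.- 1ℚ)) :* A :+ c₂ :* D :- B)) LR.refl zL A B D c₂ c₃ c₄ cₑ cₙ ⟩
    ((zL *L zL +L cₑ) *L B +L cₙ *L D) -L ((zL +L constL (ℚ.- 1ℚ)) *L ((zL +L oneL) *L B +L c₃ *L A) +L c₄ *L B)
      +L c₃ *L ((zL +L constL (ℚ.- 1ℚ)) *L A +L c₂ *L D -L B)
      ≈⟨ LR.+-cong (LR.+-cong (LR.sym Q₂≋′)
          (LR.-‿cong (LR.trans (LR.+-cong (LR.*-cong (LR.refl {zL +L constL (ℚ.- 1ℚ)}) (LR.sym Q₁≋)) (LR.refl {c₄ *L B})) (LR.sym Q₂≋))))
                   (LR.*-cong (LR.refl {c₃}) (LR.trans (LR.+-cong (LR.sym B≋) (LR.refl { -L B})) (LR.-‿inverseʳ B))) ⟩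
    Q₂ -L Q₂ +L c₃ *L zeroL
      ≈⟨ solve 2 (λ Q c → Q :- Q :+ c :* con 0ℚ := con 0ℚ) LR.refl Q₂ c₃ ⟩
    zeroL ∎
    where open ≋-Reasoning
  u,v≡0 : u ≡ 0ℚ × v ≡ 0ℚ
  u,v≡0 = Monic-combination-zero {B} {D} u v monicB monicD (ℕP.m<n⇒m<1+n (ℕP.n<1+n _)) combination≋0

-- Convergents of a continued fraction

-- Pm n and Qm n are P_{n-1} and Q_{n-1}: convM starts at index -1.
module Convergents {g : Laurent} (c : CFExpansion g) (g-proper : Deg≤ g (-[1+ 0 ])) (a₀≋0 : a c 0 ≋ zeroL) where

  Pm Qm : ℕ → Laurent
  Pm = convM (a c) oneL zeroL
  Qm = convM (a c) zeroL oneL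

  err : ℕ → Laurent
  err n = Qm n *L g -L Pm n

  fracPart : ℕ → Laurent
  fracPart i = x c i -L a c i

  Pm-IsPoly : ∀ n → IsPoly (Pm n)
  Pm-IsPoly zero = IsPoly-const 1ℚ
  Pm-IsPoly (suc zero) = IsPoly-const 0ℚ
  Pm-IsPoly (suc (suc n)) =
    IsPoly-add (a c (suc n) *L Pm (suc n)) (Pm n) (IsPoly-mul (a c (suc n)) (Pm (suc n)) (poly c (suc n)) (Pm-IsPoly (suc n))) (Pm-IsPoly n)

  Qm-IsPoly : ∀ n → IsPoly (Qm n)
  Qm-IsPoly zero = IsPoly-const 0ℚ
  Qm-IsPoly (suc zero) = IsPoly-const 1ℚ
  Qm-IsPoly (suc (suc n)) =
    IsPoly-add (a c (suc n) *L Qm (suc n)) (Qm n) (IsPoly-mul (a c (suc n)) (Qm (suc n)) (poly c (suc n)) (Qm-IsPoly (suc n))) (Qm-IsPoly n)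

  Deg≤-fracPart : ∀ i → Deg≤ (fracPart i) (-[1+ 0 ])
  Deg≤-fracPart i j p = frac c i j (ℤP.i<j⇒suc[i]≤j p)

  fracPart₀≋g : fracPart 0 ≋ g
  fracPart₀≋g = begin
    x c 0 -L a c 0   ≈⟨ LR.+-cong ⟪ start c ⟫ (LR.-‿cong a₀≋0) ⟩
    g -L zeroL       ≈⟨ solve 1 (λ G → G :- con 0ℚ := G) LR.refl g ⟩
    g ∎
    where open ≋-Reasoning

  err₀≋ : err 0 ≋ -L oneL
  err₀≋ = solve 1 (λ G → con 0ℚ :* G :- con 1ℚ := :- con 1ℚ) LR.refl g

  err₁≋g : err 1 ≋ g
  err₁≋g = solve 1 (λ G → con 1ℚ :* G :- con 0ℚ := G) LR.refl g

  err-recurrence : ∀ n → err (suc (suc n)) ≋ a c (suc n) *L err (suc n) +L err n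
  err-recurrence n = solve 6 (λ A Q₁ Q₀ P₁ P₀ G → (A :* Q₁ :+ Q₀) :* G :- (A :* P₁ :+ P₀) := A :* (Q₁ :* G :- P₁) :+ (Q₀ :* G :- P₀))
                           LR.refl (a c (suc n)) (Qm (suc n)) (Qm n) (Pm (suc n)) (Pm n) g

  err*x≋ : ∀ n → err (suc n) *L x c (suc n) ≋ -L err n
  err-next : ∀ n → err (suc (suc n)) ≋ -L (err (suc n) *L fracPart (suc n))

  err*x≋ zero = begin
    err 1 *L x c 1              ≈⟨ LR.*-cong (LR.trans err₁≋g (LR.sym fracPart₀≋g)) (LR.refl {x c 1}) ⟩
    fracPart 0 *L x c 1         ≈⟨ ⟪ step c 0 ⟫ ⟩
    oneL                        ≈⟨ solve 0 (con 1ℚ := :- (:- con 1ℚ)) LR.refl ⟩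
    -L (-L oneL)                ≈⟨ LR.-‿cong (LR.sym err₀≋) ⟩
    -L err 0 ∎
    where open ≋-Reasoning
  err*x≋ (suc n) = begin
    err (2 + n) *L x c (2 + n)
      ≈⟨ LR.*-cong (err-next n) (LR.refl {x c (2 + n)}) ⟩
    -L (err (1 + n) *L fracPart (1 + n)) *L x c (2 + n)
      ≈⟨ solve 3 (λ E F X → :- (E :* F) :* X := :- (E :* (F :* X))) LR.refl (err (1 + n)) (fracPart (1 + n)) (x c (2 + n)) ⟩
    -L (err (1 + n) *L (fracPart (1 + n) *L x c (2 + n)))
      ≈⟨ LR.-‿cong (LR.*-cong (LR.refl {err (1 + n)}) ⟪ step c (1 + n) ⟫) ⟩
    -L (err (1 + n) *L oneL)
      ≈⟨ LR.-‿cong (LR.*-identityʳ (err (1 + n))) ⟩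
    -L err (1 + n) ∎
    where open ≋-Reasoning

  err-next n = begin
    err (2 + n)
      ≈⟨ err-recurrence n ⟩
    a c (1 + n) *L err (1 + n) +L err n
      ≈⟨ LR.+-cong (LR.refl {a c (1 + n) *L err (1 + n)})
          (LR.trans (solve 1 (λ E → E := :- (:- E)) LR.refl (err n)) (LR.-‿cong (LR.sym (err*x≋ n)))) ⟩
    a c (1 + n) *L err (1 + n) +L -L (err (1 + n) *L x c (1 + n))
      ≈⟨ solve 3 (λ A E X → A :* E :+ :- (E :* X) := :- (E :* (X :- A))) LR.refl (a c (1 + n)) (err (1 + n)) (x c (1 + n)) ⟩
    -L (err (1 + n) *L fracPart (1 + n)) ∎
    where open ≋-Reasoning

  Deg≤-err : ∀ n → Deg≤ (err (suc n)) (-[1+ n ])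
  Deg≤-err zero = Deg≤-≈ g (err 1) (-[1+ 0 ]) (un (LR.sym err₁≋g)) g-proper
  Deg≤-err (suc n) =
    Deg≤-≈ (-L (err (suc n) *L fracPart (suc n))) (err (2 + n)) (-[1+ suc n ]) (un (LR.sym (err-next n)))
      (Deg≤-neg (err (suc n) *L fracPart (suc n)) (-[1+ suc n ])
        (Deg≤-mono {err (suc n) *L fracPart (suc n)}
            (Deg≤-mul (err (suc n)) (fracPart (suc n)) (-[1+ n ]) (-[1+ 0 ]) (Deg≤-err n) (Deg≤-fracPart (suc n)))
          (ℤP.≤-reflexive (cong (λ w → -[1+ suc w ]) (ℕP.+-identityʳ n)))))

  det : ℕ → Laurent
  det n = Pm (suc n) *L Qm n -L Pm n *L Qm (suc n)

  det≋ : ∀ n → det n ≋ constL (negOnePow (suc n))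
  det≋ zero = solve 0 (con 0ℚ :* con 0ℚ :- con 1ℚ :* con 1ℚ := con (ℚ.- 1ℚ)) LR.refl
  det≋ (suc n) = begin
    det (suc n)
      ≈⟨ solve 5 (λ A P₁ P₀ Q₁ Q₀ → (A :* P₁ :+ P₀) :* Q₁ :- P₁ :* (A :* Q₁ :+ Q₀) := :- (P₁ :* Q₀ :- P₀ :* Q₁))
                 LR.refl (a c (suc n)) (Pm (suc n)) (Pm n) (Qm (suc n)) (Qm n) ⟩
    -L det n
      ≈⟨ LR.-‿cong (det≋ n) ⟩
    -L constL (negOnePow (suc n))
      ≈⟨ LR.sym (constL-neg (negOnePow (suc n))) ⟩
    constL (negOnePow (suc (suc n))) ∎
    where open ≋-Reasoning

  -- A polynomial approximation Px / Qx to g of the quality of the convergent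
  -- Pm (2 + m) / Qm (2 + m) is proportional to it: the two cross determinants
  -- with the neighbouring convergents are polynomials of degree < 0 and ≤ 0.
  module BestApproximation (m : ℕ) (Qx Px : Laurent) (Qx-poly : IsPoly Qx) (Px-poly : IsPoly Px)
                           (Qx-deg : Deg≤ Qx (+ suc m)) (error-deg : Deg≤ (Qx *L g -L Px) (-[1+ suc m ]))
                           (Q₁-deg : Deg≤ (Qm (2 + m)) (+ suc m)) (Q₀-deg : Deg≤ (Qm (1 + m)) (+ m)) where

    private
      Q₁ P₁ Q₀ P₀ E v w : Laurent
      Q₁ = Qm (2 + m)
      P₁ = Pm (2 + m)
      Q₀ = Qm (1 + m)
      P₀ = Pm (1 + m)
      E = Qx *L g -L Px
      v = Q₁ *L Px -L P₁ *L Qx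
      w = Q₀ *L Px -L P₀ *L Qx

      cross≋ : ∀ Qc Pc → Qc *L Px -L Pc *L Qx ≋ Qx *L (Qc *L g -L Pc) -L Qc *L E
      cross≋ Qc Pc = solve 5 (λ Qx Px Qc Pc G → Qc :* Px :- Pc :* Qx := Qx :* (Qc :* G :- Pc) :- Qc :* (Qx :* G :- Px))
                           LR.refl Qx Px Qc Pc g

      degree-sum : ∀ a → + a +ᶻ -[1+ a ] ≡ -[1+ 0 ]
      degree-sum a = lem (+ a)
        where lem : ∀ a → a +ᶻ -ᶻ (+ 1 +ᶻ a) ≡ -ᶻ (+ 1)
              lem = zsolve-∀

      v-deg : Deg≤ v (-[1+ 0 ])
      v-deg = Deg≤-≈ (Qx *L err (2 + m) -L Q₁ *L E) v (-[1+ 0 ]) (un (LR.sym (cross≋ Q₁ P₁)))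
        (Deg≤-sub (Qx *L err (2 + m)) (Q₁ *L E) (-[1+ 0 ])
          (Deg≤-mono {Qx *L err (2 + m)} (Deg≤-mul Qx (err (2 + m)) (+ suc m) (-[1+ suc m ]) Qx-deg (Deg≤-err (suc m)))
              (ℤP.≤-reflexive (degree-sum (suc m))))
          (Deg≤-mono {Q₁ *L E} (Deg≤-mul Q₁ E (+ suc m) (-[1+ suc m ]) Q₁-deg error-deg) (ℤP.≤-reflexive (degree-sum (suc m)))))

      v≋0 : v ≋ zeroL
      v≋0 = ⟪ (λ k → trans (IsPoly-Deg≤-zero v v-poly v-deg k) (sym (coeff-zeroL k))) ⟫
        where
        v-poly : IsPoly v
        v-poly = IsPoly-add (Q₁ *L Px) (-L (P₁ *L Qx)) (IsPoly-mul Q₁ Px (Qm-IsPoly (2 + m)) Px-poly)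
                   (IsPoly-neg (P₁ *L Qx) (IsPoly-mul P₁ Qx (Pm-IsPoly (2 + m)) Qx-poly))

      w-deg : Deg≤ w (+ 0)
      w-deg = Deg≤-≈ (Qx *L err (1 + m) -L Q₀ *L E) w (+ 0) (un (LR.sym (cross≋ Q₀ P₀)))
        (Deg≤-sub (Qx *L err (1 + m)) (Q₀ *L E) (+ 0)
          (Deg≤-mono {Qx *L err (1 + m)} (Deg≤-mul Qx (err (1 + m)) (+ suc m) (-[1+ m ]) Qx-deg (Deg≤-err m)) (ℤP.≤-reflexive (lem₁ (+ m))))
          (Deg≤-mono {Q₀ *L E} (Deg≤-mul Q₀ E (+ m) (-[1+ suc m ]) Q₀-deg error-deg)
              (ℤP.≤-trans (ℤP.≤-reflexive (lem₂ (+ m))) (ℤP.<⇒≤ ℤ.-<+))))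
        where
        lem₁ : ∀ a → (+ 1 +ᶻ a) +ᶻ -ᶻ (+ 1 +ᶻ a) ≡ + 0
        lem₁ = zsolve-∀
        lem₂ : ∀ a → a +ᶻ -ᶻ (+ 1 +ᶻ (+ 1 +ᶻ a)) ≡ -ᶻ (+ 2)
        lem₂ = zsolve-∀

      w₀ s : ℚ
      w₀ = coeff w (+ 0)
      s = negOnePow (2 + m)

      w≋w₀ : w ≋ constL w₀
      w≋w₀ = ⟪ pointwise ⟫
        where
        w-poly : IsPoly w
        w-poly = IsPoly-add (Q₀ *L Px) (-L (P₀ *L Qx)) (IsPoly-mul Q₀ Px (Qm-IsPoly (1 + m)) Px-poly)
                   (IsPoly-neg (P₀ *L Qx) (IsPoly-mul P₀ Qx (Pm-IsPoly (1 + m)) Qx-poly))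
        pointwise : w ≈L constL w₀
        pointwise k with k ℤ.≟ + 0
        ... | yes refl = refl
        ... | no k≢0 with <⊎≥ k (+ 0)
        ...   | inj₁ k<0 = trans (w-poly k k<0) (sym (coeff-const-off w₀ k k≢0))
        ...   | inj₂ k≥0 = trans (w-deg k (ℤP.≤∧≢⇒< k≥0 (λ e → k≢0 (sym e)))) (sym (coeff-const-off w₀ k k≢0))

      proportional : ∀ X A B → X *L det (1 + m) ≋ A *L w -L B *L v → X ≋ constL (s ℚ.* w₀) *L A
      proportional X A B X·det≋ = begin
        X                                         ≈⟨ LR.sym (LR.*-identityˡ X) ⟩
        oneL *L X                                 ≈⟨ LR.*-cong s·s≋1 (LR.refl {X}) ⟩
        (constL s *L constL s) *L X               ≈⟨ solve 2 (λ S X → (S :* S) :* X := S :* (X :* S)) LR.refl (constL s) X ⟩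
        constL s *L (X *L constL s)               ≈⟨ LR.*-cong (LR.refl {constL s})
            (LR.trans (LR.*-cong (LR.refl {X}) (LR.sym (det≋ (1 + m)))) X·det≋) ⟩
        constL s *L (A *L w -L B *L v)            ≈⟨ LR.*-cong (LR.refl {constL s})
            (LR.+-cong (LR.*-cong (LR.refl {A}) w≋w₀) (LR.-‿cong (LR.*-cong (LR.refl {B}) v≋0))) ⟩
        constL s *L (A *L constL w₀ -L B *L zeroL)
          ≈⟨ solve 4 (λ S W A B → S :* (A :* W :- B :* con 0ℚ) := (S :* W) :* A) LR.refl (constL s) (constL w₀) A B ⟩
        (constL s *L constL w₀) *L A              ≈⟨ LR.*-cong (LR.sym (constL-* s w₀)) (LR.refl {A}) ⟩
        constL (s ℚ.* w₀) *L A ∎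
        where
        open ≋-Reasoning
        s·s≋1 : oneL ≋ constL s *L constL s
        s·s≋1 = LR.trans (LR.reflexive (cong constL (sym (negOnePow-square (2 + m))))) (constL-* s s)

    κ : ℚ
    κ = s ℚ.* w₀

    Qx≋κQ : Qx ≋ constL κ *L Q₁
    Qx≋κQ = proportional Qx Q₁ Q₀
        (solve 6 (λ Qx Px Q₁ P₁ Q₀ P₀ → Qx :* (P₁ :* Q₀ :- P₀ :* Q₁) := Q₁ :* (Q₀ :* Px :- P₀ :* Qx) :- Q₀ :* (Q₁ :* Px :- P₁ :* Qx))
                                          LR.refl Qx Px Q₁ P₁ Q₀ P₀)

    Px≋κP : Px ≋ constL κ *L P₁
    Px≋κP = proportional Px P₁ P₀
        (solve 6 (λ Qx Px Q₁ P₁ Q₀ P₀ → Px :* (P₁ :* Q₀ :- P₀ :* Q₁) := P₁ :* (Q₀ :* Px :- P₀ :* Qx) :- P₀ :* (Q₁ :* Px :- P₁ :* Qx))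
                                          LR.refl Qx Px Q₁ P₁ Q₀ P₀)

  normalised-convergent : ∀ m κ {X Y} d → X ≋ constL κ *L P c m → Y ≋ constL κ *L Q c m → Monic X d →
                          (P̂ c m ≋ X) × (Q̂ c m ≋ Y)
  normalised-convergent m κ {X} {Y} d X≋ Y≋ (X-deg , X-lead) = ⟪ P̂≈X ⟫ , ⟪ Q̂≈Y ⟫
    where
    coeff-X : ∀ k → coeff X k ≡ κ ℚ.* coeff (P c m) k
    coeff-X k = trans (un X≋ k) (coeff-constL-* κ (P c m) k)
    κ·lead≡1 : κ ℚ.* coeff (P c m) (+ d) ≡ 1ℚ
    κ·lead≡1 = trans (sym (coeff-X (+ d))) X-lead
    κ≢0 : κ ≢ 0ℚ
    κ≢0 = *≡1⇒nonzeroˡ κ (coeff (P c m) (+ d)) κ·lead≡1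
    P-deg : Deg≤ (P c m) (+ d)
    P-deg j d<j = *-zero-cancelˡ κ (coeff (P c m) j) κ≢0 (trans (sym (coeff-X j)) (X-deg j d<j))
    lead≢0 : coeff (P c m) (+ d) ≢ 0ℚ
    lead≢0 lead≡0 = 1≢0 (trans (sym κ·lead≡1) (trans (cong (κ ℚ.*_) lead≡0) (ℚP.*-zeroʳ κ)))
    invρ≡κ : invQ (ρ c m) ≡ κ
    invρ≡κ = trans (cong invQ (leadCoeff-spec (P c m) d P-deg lead≢0)) (invQ-unique (coeff (P c m) (+ d)) κ κ·lead≡1)
    P̂≈X : P̂ c m ≈L X
    P̂≈X k = trans (coeff-scale (invQ (ρ c m)) (P c m) k) (trans (cong (ℚ._* coeff (P c m) k) invρ≡κ) (sym (coeff-X k)))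
    Q̂≈Y : Q̂ c m ≈L Y
    Q̂≈Y k = trans (coeff-scale (invQ (ρ c m)) (Q c m) k)
              (trans (cong (ℚ._* coeff (Q c m) k) invρ≡κ) (sym (trans (un Y≋ k) (coeff-constL-* κ (Q c m) k))))

-- The substitution z ↦ z²

atZ²-coeffs : (ℕ → ℚ) → ℕ → ℚ
atZ²-coeffs c zero = c 0
atZ²-coeffs c (suc zero) = 0ℚ
atZ²-coeffs c (suc (suc i)) = atZ²-coeffs (λ j → c (suc j)) i

atZ²-coeffs-even : ∀ c i → atZ²-coeffs c (i ℕ.+ i) ≡ c i
atZ²-coeffs-even c zero = refl
atZ²-coeffs-even c (suc i) rewrite ℕP.+-suc i i = atZ²-coeffs-even (λ j → c (suc j)) i

atZ²-coeffs-odd : ∀ c i → atZ²-coeffs c (suc (i ℕ.+ i)) ≡ 0ℚ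
atZ²-coeffs-odd c zero = refl
atZ²-coeffs-odd c (suc i) rewrite ℕP.+-suc i i = atZ²-coeffs-odd (λ j → c (suc j)) i

atZ² : Laurent → Laurent
atZ² x = ⟨ top x +ᶻ top x , atZ²-coeffs (cf x) ⟩

parityℕ : ∀ n → Σ ℕ (λ q → n ≡ q ℕ.+ q) ⊎ Σ ℕ (λ q → n ≡ suc (q ℕ.+ q))
parityℕ zero = inj₁ (0 , refl)
parityℕ (suc n) with parityℕ n
... | inj₁ (q , e) = inj₂ (q , cong suc e)
... | inj₂ (q , e) = inj₁ (suc q , trans (cong suc e) (cong suc (sym (ℕP.+-suc q q))))

parity : ∀ k → Σ ℤ (λ j → k ≡ j +ᶻ j) ⊎ Σ ℤ (λ j → k ≡ j +ᶻ j +ᶻ + 1)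
parity (+ n) with parityℕ n
... | inj₁ (q , e) = inj₁ (+ q , cong +_ e)
... | inj₂ (q , e) = inj₂ (+ q , trans (cong +_ e) (ℤP.+-comm (+ 1) (+ q +ᶻ + q)))
parity -[1+ n ] with parityℕ (suc n)
... | inj₁ (q , e) = inj₁ (-ᶻ + q , trans (cong (λ w → -ᶻ (+ w)) e) (lem (+ q)))
  where lem : ∀ q → -ᶻ (q +ᶻ q) ≡ -ᶻ q +ᶻ -ᶻ q
        lem = zsolve-∀
... | inj₂ (q , e) = inj₂ (-ᶻ (+ 1 +ᶻ + q) , trans (cong (λ w → -ᶻ (+ w)) e) (lem (+ q)))
  where lem : ∀ q → -ᶻ (+ 1 +ᶻ (q +ᶻ q)) ≡ -ᶻ (+ 1 +ᶻ q) +ᶻ -ᶻ (+ 1 +ᶻ q) +ᶻ + 1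
        lem = zsolve-∀

private
  dbl< : ∀ {a b} → a <ᶻ b → a +ᶻ a <ᶻ b +ᶻ b
  dbl< p = ℤP.+-mono-< p p

coeff-atZ²-even : ∀ x j → coeff (atZ² x) (j +ᶻ j) ≡ coeff x j
coeff-atZ²-even x j with top-split (top x) j
... | inj₁ (i , e1 , e2) = trans (coeff-at (atZ² x) (j +ᶻ j) (i ℕ.+ i) eq) (trans (atZ²-coeffs-even (cf x) i) (sym (coeff-at x j i e1)))
  where
  lem : ∀ t j → t +ᶻ t -ᶻ (j +ᶻ j) ≡ (t -ᶻ j) +ᶻ (t -ᶻ j)
  lem = zsolve-∀
  eq : top x +ᶻ top x -ᶻ (j +ᶻ j) ≡ + (i ℕ.+ i)
  eq = trans (lem (top x) j) (cong₂ _+ᶻ_ e1 e1)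
... | inj₂ p = trans (Deg≤-top (atZ² x) (j +ᶻ j) (dbl< p)) (sym (Deg≤-top x j p))

coeff-atZ²-odd : ∀ x j → coeff (atZ² x) (j +ᶻ j +ᶻ + 1) ≡ 0ℚ
coeff-atZ²-odd x j with top-split (top x) j
... | inj₁ (zero , e1 , e2) = coeff-above-top (atZ² x) _ 0 (trans (lem (top x) j) (cong (λ w → w +ᶻ w -ᶻ + 1) e1))
  where lem : ∀ t j → t +ᶻ t -ᶻ (j +ᶻ j +ᶻ + 1) ≡ (t -ᶻ j) +ᶻ (t -ᶻ j) -ᶻ + 1
        lem = zsolve-∀
... | inj₁ (suc i , e1 , e2) = trans (coeff-at (atZ² x) _ (suc (i ℕ.+ i)) eq) (atZ²-coeffs-odd (cf x) i)
  where
  lem : ∀ t j → t +ᶻ t -ᶻ (j +ᶻ j +ᶻ + 1) ≡ (t -ᶻ j) +ᶻ (t -ᶻ j) -ᶻ + 1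
  lem = zsolve-∀
  lem2 : ∀ i → (+ 1 +ᶻ i) +ᶻ (+ 1 +ᶻ i) -ᶻ + 1 ≡ + 1 +ᶻ (i +ᶻ i)
  lem2 = zsolve-∀
  eq : top x +ᶻ top x -ᶻ (j +ᶻ j +ᶻ + 1) ≡ + suc (i ℕ.+ i)
  eq = trans (lem (top x) j) (trans (cong (λ w → w +ᶻ w -ᶻ + 1) e1) (lem2 (+ i)))
... | inj₂ p = Deg≤-top (atZ² x) _ (ℤP.<-trans (dbl< p) (offset-< 0 refl))

≋-by-parity : ∀ X Y → (∀ j → coeff X (j +ᶻ j) ≡ coeff Y (j +ᶻ j)) →
              (∀ j → coeff X (j +ᶻ j +ᶻ + 1) ≡ coeff Y (j +ᶻ j +ᶻ + 1)) → X ≋ Y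
≋-by-parity X Y ev od = ⟪ by-parity ⟫
  where
  by-parity : X ≈L Y
  by-parity k with parity k
  ... | inj₁ (j , refl) = ev j
  ... | inj₂ (j , refl) = od j

atZ²-cong : ∀ x y → x ≋ y → atZ² x ≋ atZ² y
atZ²-cong x y e = ≋-by-parity (atZ² x) (atZ² y) (λ j → trans (coeff-atZ²-even x j) (trans (un e j) (sym (coeff-atZ²-even y j))))
    (λ j → trans (coeff-atZ²-odd x j) (sym (coeff-atZ²-odd y j)))

atZ²-add : ∀ x y → atZ² (x +L y) ≋ (atZ² x +L atZ² y)
atZ²-add x y = ≋-by-parity (atZ² (x +L y)) (atZ² x +L atZ² y)
    (λ j → trans (coeff-atZ²-even (x +L y) j)
    (trans (coeff-add x y j) (sym (trans (coeff-add (atZ² x) (atZ² y) (j +ᶻ j))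
    (cong₂ ℚ._+_ (coeff-atZ²-even x j) (coeff-atZ²-even y j))))))
                       (λ j → trans (coeff-atZ²-odd (x +L y) j)
                           (sym (trans (coeff-add (atZ² x) (atZ² y) (j +ᶻ j +ᶻ + 1))
                           (trans (cong₂ ℚ._+_ (coeff-atZ²-odd x j) (coeff-atZ²-odd y j)) (ℚP.+-identityˡ 0ℚ)))))

atZ²-neg : ∀ x → atZ² (-L x) ≋ (-L atZ² x)
atZ²-neg x = ≋-by-parity (atZ² (-L x)) (-L atZ² x)
    (λ j → trans (coeff-atZ²-even (-L x) j)
    (trans (coeff-neg x j) (sym (trans (coeff-neg (atZ² x) (j +ᶻ j)) (cong ℚ.-_ (coeff-atZ²-even x j))))))
                     (λ j → trans (coeff-atZ²-odd (-L x) j)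
                         (sym (trans (coeff-neg (atZ² x) (j +ᶻ j +ᶻ + 1)) (cong ℚ.-_ (coeff-atZ²-odd x j)))))

atZ²-scale : ∀ r x → atZ² (r ·L x) ≋ (r ·L atZ² x)
atZ²-scale r x = ≋-by-parity (atZ² (r ·L x)) (r ·L atZ² x)
    (λ j → trans (coeff-atZ²-even (r ·L x) j)
    (trans (coeff-scale r x j) (sym (trans (coeff-scale r (atZ² x) (j +ᶻ j)) (cong (r ℚ.*_) (coeff-atZ²-even x j))))))
                     (λ j → trans (coeff-atZ²-odd (r ·L x) j)
                         (sym (trans (coeff-scale r (atZ² x) (j +ᶻ j +ᶻ + 1)) (trans (cong (r ℚ.*_) (coeff-atZ²-odd x j)) (ℚP.*-zeroʳ r)))))

Deg≤-atZ² : ∀ x a → Deg≤ x a → Deg≤ (atZ² x) (a +ᶻ a)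
Deg≤-atZ² x a v k p with parity k
... | inj₁ (j , refl) = trans (coeff-atZ²-even x j) (v j (half p))
  where half : a +ᶻ a <ᶻ j +ᶻ j → a <ᶻ j
        half q with <⊎≥ a j
        ... | inj₁ r = r
        ... | inj₂ r = ⊥-elim (ℤP.<-irrefl refl (ℤP.<-≤-trans q (ℤP.+-mono-≤ r r)))
... | inj₂ (j , refl) = coeff-atZ²-odd x j

Σz-pair : ∀ L n h → Σz (L +ᶻ L) (n ℕ.+ n) h ≡ Σz L n (λ i → h (i +ᶻ i) ℚ.+ h (i +ᶻ i +ᶻ + 1))
Σz-pair L zero h = refl
Σz-pair L (suc n) h = begin
    Σz (L +ᶻ L) (suc n ℕ.+ suc n) h
  ≡⟨ cong (λ m → Σz (L +ᶻ L) (suc m) h) (ℕP.+-suc n n) ⟩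
    (Σz (L +ᶻ L) (n ℕ.+ n) h ℚ.+ h (L +ᶻ L +ᶻ + (n ℕ.+ n))) ℚ.+ h (L +ᶻ L +ᶻ + suc (n ℕ.+ n))
  ≡⟨ ℚP.+-assoc (Σz (L +ᶻ L) (n ℕ.+ n) h) (h (L +ᶻ L +ᶻ + (n ℕ.+ n))) (h (L +ᶻ L +ᶻ + suc (n ℕ.+ n))) ⟩
    Σz (L +ᶻ L) (n ℕ.+ n) h ℚ.+ (h (L +ᶻ L +ᶻ + (n ℕ.+ n)) ℚ.+ h (L +ᶻ L +ᶻ + suc (n ℕ.+ n)))
  ≡⟨ cong₂ ℚ._+_ (Σz-pair L n h) (cong₂ ℚ._+_ (cong h (l1 L (+ n))) (cong h (l2 L (+ n)))) ⟩
    Σz L (suc n) (λ i → h (i +ᶻ i) ℚ.+ h (i +ᶻ i +ᶻ + 1)) ∎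
  where
  open ≡-Reasoning
  l1 : ∀ L n → L +ᶻ L +ᶻ (n +ᶻ n) ≡ L +ᶻ n +ᶻ (L +ᶻ n)
  l1 = zsolve-∀
  l2 : ∀ L n → L +ᶻ L +ᶻ (+ 1 +ᶻ (n +ᶻ n)) ≡ L +ᶻ n +ᶻ (L +ᶻ n) +ᶻ + 1
  l2 = zsolve-∀

atZ²-mul : ∀ x y → atZ² (x *L y) ≋ (atZ² x *L atZ² y)
atZ²-mul x y = ≋-by-parity (atZ² (x *L y)) (atZ² x *L atZ² y) ev od
  where
  tx ty : ℤ
  tx = top x
  ty = top y
  win< : ∀ L n → tx <ᶻ L +ᶻ + n → tx +ᶻ tx <ᶻ (L +ᶻ L) +ᶻ + (n ℕ.+ n)
  win< L n p = subst (tx +ᶻ tx <ᶻ_) (lem L (+ n)) (ℤP.+-mono-< p p)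
    where lem : ∀ L n → L +ᶻ n +ᶻ (L +ᶻ n) ≡ L +ᶻ L +ᶻ (n +ᶻ n)
          lem = zsolve-∀
  ev : ∀ j → coeff (atZ² (x *L y)) (j +ᶻ j) ≡ coeff (atZ² x *L atZ² y) (j +ᶻ j)
  ev j = begin
      coeff (atZ² (x *L y)) (j +ᶻ j)
    ≡⟨ coeff-atZ²-even (x *L y) j ⟩
      coeff (x *L y) j
    ≡⟨ coeff-mul-window x y j tx ty L n (Deg≤-top x) (Deg≤-top y) ℤP.≤-refl pn ⟩
      Σz L n (λ i → coeff x i ℚ.* coeff y (j -ᶻ i))
    ≡⟨ Σz-cong L n (λ i _ → sym (evpt i)) ⟩
      Σz L n (λ i → h (i +ᶻ i) ℚ.+ h (i +ᶻ i +ᶻ + 1))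
    ≡⟨ sym (Σz-pair L n h) ⟩
      Σz (L +ᶻ L) (n ℕ.+ n) h
    ≡⟨ sym (coeff-mul-window (atZ² x) (atZ² y) (j +ᶻ j) (tx +ᶻ tx) (ty +ᶻ ty) (L +ᶻ L) (n ℕ.+ n) (Deg≤-top (atZ² x))
        (Deg≤-top (atZ² y)) (ℤP.≤-reflexive (l4 j ty)) (win< L n pn)) ⟩
      coeff (atZ² x *L atZ² y) (j +ᶻ j) ∎
    where
    open ≡-Reasoning
    L : ℤ
    L = j -ᶻ ty
    n : ℕ
    n = window tx ty j
    pn : tx <ᶻ L +ᶻ + n
    pn = proj₂ (overshoot (j -ᶻ ty) tx)
    h : ℤ → ℚ
    h i = coeff (atZ² x) i ℚ.* coeff (atZ² y) (j +ᶻ j -ᶻ i)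
    l3 : ∀ j i → j +ᶻ j -ᶻ (i +ᶻ i) ≡ (j -ᶻ i) +ᶻ (j -ᶻ i)
    l3 = zsolve-∀
    l4 : ∀ j ty → j -ᶻ ty +ᶻ (j -ᶻ ty) ≡ j +ᶻ j -ᶻ (ty +ᶻ ty)
    l4 = zsolve-∀
    evpt : ∀ i → h (i +ᶻ i) ℚ.+ h (i +ᶻ i +ᶻ + 1) ≡ coeff x i ℚ.* coeff y (j -ᶻ i)
    evpt i = trans (cong₂ ℚ._+_ (cong₂ ℚ._*_ (coeff-atZ²-even x i) (trans (cong (coeff (atZ² y)) (l3 j i)) (coeff-atZ²-even y (j -ᶻ i))))

                                    (trans (cong (ℚ._* coeff (atZ² y) (j +ᶻ j -ᶻ (i +ᶻ i +ᶻ + 1))) (coeff-atZ²-odd x i))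
                                    (ℚP.*-zeroˡ (coeff (atZ² y) (j +ᶻ j -ᶻ (i +ᶻ i +ᶻ + 1))))))
                   (ℚP.+-identityʳ (coeff x i ℚ.* coeff y (j -ᶻ i)))
  od : ∀ j → coeff (atZ² (x *L y)) (j +ᶻ j +ᶻ + 1) ≡ coeff (atZ² x *L atZ² y) (j +ᶻ j +ᶻ + 1)
  od j = begin
      coeff (atZ² (x *L y)) (j +ᶻ j +ᶻ + 1)
    ≡⟨ coeff-atZ²-odd (x *L y) j ⟩
      0ℚ
    ≡⟨ sym (Σz-zero L n (λ i _ → odpt i)) ⟩
      Σz L n (λ i → h (i +ᶻ i) ℚ.+ h (i +ᶻ i +ᶻ + 1))
    ≡⟨ sym (Σz-pair L n h) ⟩
      Σz (L +ᶻ L) (n ℕ.+ n) h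
    ≡⟨ sym (coeff-mul-window (atZ² x) (atZ² y) k (tx +ᶻ tx) (ty +ᶻ ty) (L +ᶻ L) (n ℕ.+ n) (Deg≤-top (atZ² x)) (Deg≤-top (atZ² y))
        (offset-≤ 1 (l4 j ty)) (win< L n pn)) ⟩
      coeff (atZ² x *L atZ² y) k ∎
    where
    open ≡-Reasoning
    k : ℤ
    k = j +ᶻ j +ᶻ + 1
    L : ℤ
    L = j -ᶻ ty
    n : ℕ
    n = window tx ty j
    pn : tx <ᶻ L +ᶻ + n
    pn = proj₂ (overshoot (j -ᶻ ty) tx)
    h : ℤ → ℚ
    h i = coeff (atZ² x) i ℚ.* coeff (atZ² y) (k -ᶻ i)
    l3 : ∀ j i → j +ᶻ j +ᶻ + 1 -ᶻ (i +ᶻ i) ≡ (j -ᶻ i) +ᶻ (j -ᶻ i) +ᶻ + 1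
    l3 = zsolve-∀
    l4 : ∀ j ty → j +ᶻ j +ᶻ + 1 -ᶻ (ty +ᶻ ty) ≡ j -ᶻ ty +ᶻ (j -ᶻ ty) +ᶻ + 1
    l4 = zsolve-∀
    odpt : ∀ i → h (i +ᶻ i) ℚ.+ h (i +ᶻ i +ᶻ + 1) ≡ 0ℚ
    odpt i = trans (cong₂ ℚ._+_
        (trans (cong (coeff (atZ² x) (i +ᶻ i) ℚ.*_) (trans (cong (coeff (atZ² y)) (l3 j i)) (coeff-atZ²-odd y (j -ᶻ i))))
        (ℚP.*-zeroʳ (coeff (atZ² x) (i +ᶻ i))))

                                    (trans (cong (ℚ._* coeff (atZ² y) (k -ᶻ (i +ᶻ i +ᶻ + 1))) (coeff-atZ²-odd x i))
                                    (ℚP.*-zeroˡ (coeff (atZ² y) (k -ᶻ (i +ᶻ i +ᶻ + 1))))))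
                   (ℚP.+-identityʳ 0ℚ)

atZ²-const : ∀ r → atZ² (constL r) ≋ constL r
atZ²-const r = ≋-by-parity (atZ² (constL r)) (constL r) ev od
  where
  ev : ∀ j → coeff (atZ² (constL r)) (j +ᶻ j) ≡ coeff (constL r) (j +ᶻ j)
  ev j with j ℤ.≟ + 0
  ... | yes refl = coeff-atZ²-even (constL r) (+ 0)
  ... | no ne = trans (coeff-atZ²-even (constL r) j) (trans (coeff-const-off r j ne) (sym (coeff-const-off r (j +ᶻ j) (λ e → ne (half e)))))
    where half : j +ᶻ j ≡ + 0 → j ≡ + 0
          half e with <⊎≥ j (+ 0)
          ... | inj₁ p = ⊥-elim (ℤP.<-irrefl e (ℤP.+-mono-< p p))
          ... | inj₂ p with ≤⊎> j (+ 0)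
          ... | inj₁ q = ℤP.≤-antisym q p
          ... | inj₂ q = ⊥-elim (ℤP.<-irrefl (sym e) (ℤP.+-mono-< q q))
  od : ∀ j → coeff (atZ² (constL r)) (j +ᶻ j +ᶻ + 1) ≡ coeff (constL r) (j +ᶻ j +ᶻ + 1)
  od j = trans (coeff-atZ²-odd (constL r) j) (sym (coeff-const-off r _ (odd≢ j)))
    where odd≢ : ∀ j → j +ᶻ j +ᶻ + 1 ≢ + 0
          odd≢ j e with <⊎≥ j (+ 0)
          ... | inj₂ p = ℤP.<-irrefl (sym e) (ℤP.<-≤-trans (offset-< 0 refl) (ℤP.+-monoˡ-≤ (+ 1) (ℤP.+-mono-≤ p p)))
          ... | inj₁ p = ℤP.<-irrefl e (ℤP.≤-<-trans (ℤP.+-monoˡ-≤ (+ 1) (ℤP.+-mono-≤ q q)) (ℤ.-<+ {0} {0}))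
            where q : j ≤ᶻ -[1+ 0 ]
                  q with <-offset p
                  ... | d , eq = offset-≤ d (trans (cong (λ w → w -ᶻ + 1) eq) (lem j (+ d)))
                    where lem : ∀ j d → j +ᶻ (+ 1 +ᶻ d) -ᶻ + 1 ≡ j +ᶻ d
                          lem = zsolve-∀

IsPoly-atZ² : ∀ x → IsPoly x → IsPoly (atZ² x)
IsPoly-atZ² x px k p with parity k
... | inj₁ (j , refl) = trans (coeff-atZ²-even x j) (px j (half p))
  where half : j +ᶻ j <ᶻ + 0 → j <ᶻ + 0
        half q with <⊎≥ j (+ 0)
        ... | inj₁ r = r
        ... | inj₂ r = ⊥-elim (ℤP.<-irrefl refl (ℤP.<-≤-trans q (ℤP.+-mono-≤ r r)))
... | inj₂ (j , refl) = coeff-atZ²-odd x j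

private
  dbl≢1 : ∀ j → j +ᶻ j ≢ + 1
  dbl≢1 j e with <⊎≥ j (+ 1)
  ... | inj₂ p = ℤP.<-irrefl (sym e) (ℤP.<-≤-trans (offset-< 0 refl) (ℤP.+-mono-≤ p p))
  ... | inj₁ p = ℤP.<-irrefl e (ℤP.≤-<-trans (ℤP.+-mono-≤ q q) (ℤ.+<+ (s≤s z≤n)))
    where q : j ≤ᶻ + 0
          q with <-offset p
          ... | d , eq = offset-≤ d (cancelz j d eq)
            where cancelz : ∀ j d → + 1 ≡ j +ᶻ (+ 1 +ᶻ + d) → + 0 ≡ j +ᶻ + d
                  cancelz j d e = trans (cong (λ w → w -ᶻ + 1) e) (lem j (+ d))
                    where lem : ∀ j d → j +ᶻ (+ 1 +ᶻ d) -ᶻ + 1 ≡ j +ᶻ d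
                          lem = zsolve-∀

atZ²-z : atZ² zL ≋ (zL *L zL)
atZ²-z = ≋-by-parity (atZ² zL) (zL *L zL) ev od
  where
  ev : ∀ j → coeff (atZ² zL) (j +ᶻ j) ≡ coeff (zL *L zL) (j +ᶻ j)
  ev j with j ℤ.≟ + 1
  ... | yes refl = trans (coeff-atZ²-even zL (+ 1)) (sym (coeff-zL-* zL (+ 2)))
  ... | no ne = trans (coeff-atZ²-even zL j) (trans (coeff-z-off j ne) (sym (trans (coeff-zL-* zL (j +ᶻ j)) (coeff-z-off _ ne'))))
    where ne' : j +ᶻ j -ᶻ + 1 ≢ + 1
          ne' e = ne (half (trans (lem j) (cong (λ w → w +ᶻ + 1) e)))
            where lem : ∀ j → j +ᶻ j ≡ j +ᶻ j -ᶻ + 1 +ᶻ + 1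
                  lem = zsolve-∀
                  half : j +ᶻ j ≡ + 2 → j ≡ + 1
                  half e2 with <⊎≥ j (+ 1)
                  ... | inj₂ p with ≤⊎> j (+ 1)
                  ... | inj₁ q = ℤP.≤-antisym q p
                  ... | inj₂ q = ⊥-elim (ℤP.<-irrefl (sym e2) (ℤP.+-mono-< q q))
                  half e2 | inj₁ p = ⊥-elim (ℤP.<-irrefl e2 (ℤP.+-mono-< p p))
  od : ∀ j → coeff (atZ² zL) (j +ᶻ j +ᶻ + 1) ≡ coeff (zL *L zL) (j +ᶻ j +ᶻ + 1)
  od j = trans (coeff-atZ²-odd zL j)
      (sym (trans (coeff-zL-* zL (j +ᶻ j +ᶻ + 1)) (trans (cong (coeff zL) (lem j)) (coeff-z-off (j +ᶻ j) (dbl≢1 j)))))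
    where lem : ∀ j → j +ᶻ j +ᶻ + 1 -ᶻ + 1 ≡ j +ᶻ j
          lem = zsolve-∀

atZ²-recurrence : ∀ r s X Y → atZ² ((zL +L constL r) *L X +L constL s *L Y) ≋ (zL *L zL +L constL r) *L atZ² X +L constL s *L atZ² Y
atZ²-recurrence r s X Y = begin
  atZ² ((zL +L constL r) *L X +L constL s *L Y)
    ≈⟨ atZ²-add ((zL +L constL r) *L X) (constL s *L Y) ⟩
  atZ² ((zL +L constL r) *L X) +L atZ² (constL s *L Y)
    ≈⟨ LR.+-cong (atZ²-mul (zL +L constL r) X) (atZ²-mul (constL s) Y) ⟩
  atZ² (zL +L constL r) *L atZ² X +L atZ² (constL s) *L atZ² Y
    ≈⟨ LR.+-cong (LR.*-cong (LR.trans (atZ²-add zL (constL r)) (LR.+-cong atZ²-z (atZ²-const r))) (LR.refl {atZ² X}))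
                 (LR.*-cong (atZ²-const s) (LR.refl {atZ² Y})) ⟩
  (zL *L zL +L constL r) *L atZ² X +L constL s *L atZ² Y ∎
  where open ≋-Reasoning

-- The Thue–Morse series

tmF-zero : ∀ k → tmF k 0 ≡ false
tmF-zero zero = refl
tmF-zero (suc k) = tmF-zero k

half≤ : ∀ n k → suc n ≤ suc k → (suc n) / 2 ≤ k
half≤ n k p = ℕP.≤-pred (ℕP.<-≤-trans (m/n<m (suc n) 2 (s≤s (s≤s z≤n))) p)

tmF-fuel : ∀ k k' n → n ≤ k → n ≤ k' → tmF k n ≡ tmF k' n
tmF-fuel k k' zero p q = trans (tmF-zero k) (sym (tmF-zero k'))
tmF-fuel (suc k) (suc k') (suc n) p q
  rewrite tmF-fuel k k' ((suc n) / 2) (half≤ n k p) (half≤ n k' q) = refl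

m+m≡m*2 : ∀ m → m ℕ.+ m ≡ m ℕ.* 2
m+m≡m*2 m = trans (cong (m ℕ.+_) (sym (ℕP.+-identityʳ m))) (ℕP.*-comm 2 m)

even%2 : ∀ m → (m ℕ.+ m) % 2 ≡ 0
even%2 m = trans (cong (_% 2) (m+m≡m*2 m)) (m*n%n≡0 m 2)

even/2 : ∀ m → (m ℕ.+ m) / 2 ≡ m
even/2 m = trans (cong (_/ 2) (m+m≡m*2 m)) (m*n/n≡m m 2)

odd%2 : ∀ m → (suc (m ℕ.+ m)) % 2 ≡ 1
odd%2 m = trans (cong (λ w → (1 ℕ.+ w) % 2) (m+m≡m*2 m)) ([m+kn]%n≡m%n 1 m 2)

odd/2 : ∀ m → (suc (m ℕ.+ m)) / 2 ≡ m
odd/2 m = trans (cong (λ w → (1 ℕ.+ w) / 2) (m+m≡m*2 m))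
    (trans (+-distrib-/ 1 (m ℕ.* 2) (subst (λ w → 1 ℕ.+ w < 2) (sym (m*n%n≡0 m 2)) (s≤s (s≤s z≤n)))) (m*n/n≡m m 2))

tm-even : ∀ m → tm (m ℕ.+ m) ≡ tm m
tm-even zero = refl
tm-even (suc m) = begin
    tmF (suc m ℕ.+ suc m) (suc m ℕ.+ suc m)
  ≡⟨ refl ⟩
    (if ((suc m ℕ.+ suc m) % 2) ℕ.≡ᵇ 1 then not (tmF (m ℕ.+ suc m) ((suc m ℕ.+ suc m) / 2)) else tmF (m ℕ.+ suc m) ((suc m ℕ.+ suc m) / 2))
  ≡⟨ cong (λ w → if w ℕ.≡ᵇ 1 then not (tmF (m ℕ.+ suc m) ((suc m ℕ.+ suc m) / 2)) else tmF (m ℕ.+ suc m) ((suc m ℕ.+ suc m) / 2))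
      (even%2 (suc m)) ⟩
    tmF (m ℕ.+ suc m) ((suc m ℕ.+ suc m) / 2)
  ≡⟨ cong (tmF (m ℕ.+ suc m)) (even/2 (suc m)) ⟩
    tmF (m ℕ.+ suc m) (suc m)
  ≡⟨ tmF-fuel (m ℕ.+ suc m) (suc m) (suc m) (ℕP.m≤n+m (suc m) m) ℕP.≤-refl ⟩
    tm (suc m) ∎
  where open ≡-Reasoning

tm-odd : ∀ m → tm (suc (m ℕ.+ m)) ≡ not (tm m)
tm-odd m = begin
    tmF (suc (m ℕ.+ m)) (suc (m ℕ.+ m))
  ≡⟨ refl ⟩
    (if ((suc (m ℕ.+ m)) % 2) ℕ.≡ᵇ 1 then not (tmF (m ℕ.+ m) ((suc (m ℕ.+ m)) / 2)) else tmF (m ℕ.+ m) ((suc (m ℕ.+ m)) / 2))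
  ≡⟨ cong (λ w → if w ℕ.≡ᵇ 1 then not (tmF (m ℕ.+ m) ((suc (m ℕ.+ m)) / 2)) else tmF (m ℕ.+ m) ((suc (m ℕ.+ m)) / 2)) (odd%2 m) ⟩
    not (tmF (m ℕ.+ m) ((suc (m ℕ.+ m)) / 2))
  ≡⟨ cong (λ w → not (tmF (m ℕ.+ m) w)) (odd/2 m) ⟩
    not (tmF (m ℕ.+ m) m)
  ≡⟨ cong not (tmF-fuel (m ℕ.+ m) m m (ℕP.m≤n+m m m) ℕP.≤-refl) ⟩
    not (tm m) ∎
  where open ≡-Reasoning

coeff-fTM-neg : ∀ m → coeff fTM (-[1+ m ]) ≡ signB (tm m)
coeff-fTM-neg m = coeff-at fTM (-[1+ m ]) m (lem (+ m))
  where lem : ∀ m → -ᶻ (+ 1) -ᶻ (-ᶻ (+ 1 +ᶻ m)) ≡ m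
        lem = zsolve-∀

coeff-fTM-nonneg : ∀ k → + 0 ≤ᶻ k → coeff fTM k ≡ 0ℚ
coeff-fTM-nonneg k p = Deg≤-top fTM k (ℤP.<-≤-trans ℤ.-<+ p)

Deg≤-fTM : Deg≤ fTM (-[1+ 0 ])
Deg≤-fTM = Deg≤-top fTM

signB-not : ∀ b → signB (not b) ≡ ℚ.- signB b
signB-not true = refl
signB-not false = refl

coeff-fTM-even : ∀ j → coeff fTM (j +ᶻ j) ≡ ℚ.- coeff fTM j
coeff-fTM-even (+ n) = trans (coeff-fTM-nonneg (+ n +ᶻ + n) (ℤ.+≤+ z≤n)) (sym (cong ℚ.-_ (coeff-fTM-nonneg (+ n) (ℤ.+≤+ z≤n))))
coeff-fTM-even -[1+ m ] = trans (coeff-fTM-neg (suc (m ℕ.+ m)))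
  (trans (cong signB (tm-odd m)) (trans (signB-not (tm m)) (cong ℚ.-_ (sym (coeff-fTM-neg m)))))

coeff-fTM-odd : ∀ j → coeff fTM (j +ᶻ j +ᶻ + 1) ≡ coeff fTM j
coeff-fTM-odd (+ n) = trans (coeff-fTM-nonneg (+ n +ᶻ + n +ᶻ + 1) (ℤ.+≤+ z≤n)) (sym (coeff-fTM-nonneg (+ n) (ℤ.+≤+ z≤n)))
coeff-fTM-odd -[1+ m ] = trans (cong (coeff fTM) (lem (+ m)))
  (trans (coeff-fTM-neg (m ℕ.+ m)) (trans (cong signB (tm-even m)) (sym (coeff-fTM-neg m))))
  where
  lem : ∀ m → -ᶻ (+ 1 +ᶻ m) +ᶻ -ᶻ (+ 1 +ᶻ m) +ᶻ + 1 ≡ -ᶻ (+ 1 +ᶻ (m +ᶻ m))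
  lem = zsolve-∀

fTM-functional-equation : fTM ≋ (zL -L oneL) *L atZ² fTM
fTM-functional-equation = ≋-by-parity fTM ((zL -L oneL) *L S) ev od
  where
  S : Laurent
  S = atZ² fTM
  coeff-rhs : ∀ k → coeff ((zL -L oneL) *L S) k ≡ coeff S (k -ᶻ + 1) ℚ.- coeff S k
  coeff-rhs k = trans (un (solve 2 (λ Z S → (Z :- con 1ℚ) :* S := Z :* S :- con 1ℚ :* S) LR.refl zL S) k)
    (trans (coeff-sub (zL *L S) (oneL *L S) k) (cong₂ ℚ._-_ (coeff-zL-* S k) (*L-identityˡ S k)))
  ev : ∀ j → coeff fTM (j +ᶻ j) ≡ coeff ((zL -L oneL) *L S) (j +ᶻ j)
  ev j = sym (trans (coeff-rhs (j +ᶻ j))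
      (trans (cong₂ ℚ._-_ (trans (cong (coeff S) (lem j)) (coeff-atZ²-odd fTM (j -ᶻ + 1))) (coeff-atZ²-even fTM j))
      (trans (ℚP.+-identityˡ _) (sym (coeff-fTM-even j)))))
    where
    lem : ∀ j → j +ᶻ j -ᶻ + 1 ≡ (j -ᶻ + 1) +ᶻ (j -ᶻ + 1) +ᶻ + 1
    lem = zsolve-∀
  od : ∀ j → coeff fTM (j +ᶻ j +ᶻ + 1) ≡ coeff ((zL -L oneL) *L S) (j +ᶻ j +ᶻ + 1)
  od j = sym (trans (coeff-rhs (j +ᶻ j +ᶻ + 1))
      (trans (cong₂ ℚ._-_ (trans (cong (coeff S) (lem j)) (coeff-atZ²-even fTM j)) (coeff-atZ²-odd fTM j))
      (trans (ℚP.+-identityʳ (coeff fTM j)) (sym (coeff-fTM-odd j)))))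
    where
    lem : ∀ j → j +ᶻ j +ᶻ + 1 -ᶻ + 1 ≡ j +ᶻ j
    lem = zsolve-∀

-- The continued fraction of the Thue–Morse series

module ThueMorseExpansion (c : CFExpansion fTM) (β : ℕ → ℚ) (hyp : DefinesBeta c β) where

  a≡x-nonneg : ∀ i k → + 0 ≤ᶻ k → coeff (a c i) k ≡ coeff (x c i) k
  a≡x-nonneg i k 0≤k = sym (x∙y⁻¹≈ε⇒x≈y (coeff (x c i) k) (coeff (a c i) k) (trans (sym (coeff-sub (x c i) (a c i) k)) (frac c i k 0≤k)))

  a₀≋0 : a c 0 ≋ zeroL
  a₀≋0 = ⟪ pointwise ⟫
    where
    pointwise : a c 0 ≈L zeroL
    pointwise k with <⊎≥ k (+ 0)
    ... | inj₁ k<0 = trans (poly c 0 k k<0) (sym (coeff-zeroL k))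
    ... | inj₂ k≥0 = trans (a≡x-nonneg 0 k k≥0) (trans (start c k) (trans (coeff-fTM-nonneg k k≥0) (sym (coeff-zeroL k))))

  open Convergents c Deg≤-fTM a₀≋0

  Deg≤-a : ∀ i → Deg≤ (x c i) (+ 1) → Deg≤ (a c i) (+ 1)
  Deg≤-a i x-deg k 1<k = trans (a≡x-nonneg i k (ℤP.<⇒≤ (ℤP.≤-<-trans (ℤ.+≤+ z≤n) 1<k))) (x-deg k 1<k)

  fTM-lead≢0 : coeff fTM (-[1+ 0 ]) ≢ 0ℚ
  fTM-lead≢0 ()

  fTM*x₁≋1 : fTM *L x c 1 ≋ oneL
  fTM*x₁≋1 = LR.trans (LR.*-cong (LR.sym fracPart₀≋g) (LR.refl {x c 1})) ⟪ step c 0 ⟫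

  module Quotient₁ = Quotient (x c 1) fTM oneL (-[1+ 0 ]) (+ 0) (un fTM*x₁≋1) Deg≤-fTM fTM-lead≢0 (Deg≤-const 1ℚ)

  Deg≤-Q₁ : Deg≤ (Q c 1) (+ 1)
  Deg≤-Q₁ = Deg≤-add (a c 1 *L oneL) zeroL (+ 1) (Deg≤-mul (a c 1) oneL (+ 1) (+ 0) (Deg≤-a 1 Quotient₁.Deg≤-quotient) (Deg≤-const 1ℚ))
                     (Deg≤-constL 0ℚ 1)

  -- The coefficients not covered by the degree bound vanish by evaluation (refl).
  first-error-deg : Deg≤ ((zL +L oneL) *L fTM -L oneL) (-[1+ 1 ])
  first-error-deg = Deg≤-pred E (-[1+ 1 ]) (Deg≤-pred E (-[1+ 0 ]) deg₀ refl) refl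
    where
    E : Laurent
    E = (zL +L oneL) *L fTM -L oneL
    deg₀ : Deg≤ E (+ 0)
    deg₀ = Deg≤-sub ((zL +L oneL) *L fTM) oneL (+ 0) (Deg≤-mul (zL +L oneL) fTM (+ 1) (-[1+ 0 ]) (Deg≤-z+const 1ℚ) Deg≤-fTM) (Deg≤-const 1ℚ)

  module Approximation₁ = BestApproximation 0 (zL +L oneL) oneL (IsPoly-add zL oneL IsPoly-z (IsPoly-const 1ℚ)) (IsPoly-const 1ℚ)
                                          (Deg≤-z+const 1ℚ) first-error-deg Deg≤-Q₁ (Deg≤-const 1ℚ)

  P̂Q̂₁ : (P̂ c 1 ≋ oneL) × (Q̂ c 1 ≋ zL +L oneL)
  P̂Q̂₁ = normalised-convergent 1 Approximation₁.κ 0 Approximation₁.Px≋κP Approximation₁.Qx≋κQ (Deg≤-const 1ℚ , refl)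

  first-error≋ : (zL +L oneL) *L fTM -L oneL ≋ constL Approximation₁.κ *L err 2
  first-error≋ = begin
    (zL +L oneL) *L fTM -L oneL
      ≈⟨ LR.+-cong (LR.*-cong Approximation₁.Qx≋κQ (LR.refl {fTM})) (LR.-‿cong Approximation₁.Px≋κP) ⟩
    (constL κ *L Q c 1) *L fTM -L constL κ *L P c 1
      ≈⟨ solve 4 (λ K Q F P → (K :* Q) :* F :- K :* P := K :* (Q :* F :- P)) LR.refl (constL κ) (Q c 1) fTM (P c 1) ⟩
    constL κ *L err 2 ∎
    where
    open ≋-Reasoning
    κ : ℚ
    κ = Approximation₁.κ

  err₂-lead≢0 : coeff (err 2) (-[1+ 1 ]) ≢ 0ℚ
  err₂-lead≢0 lead≡0 = first-error-lead≢0 (begin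
    coeff ((zL +L oneL) *L fTM -L oneL) (-[1+ 1 ])   ≡⟨ un first-error≋ (-[1+ 1 ]) ⟩
    coeff (constL κ *L err 2) (-[1+ 1 ])             ≡⟨ coeff-constL-* κ (err 2) (-[1+ 1 ]) ⟩
    κ ℚ.* coeff (err 2) (-[1+ 1 ])                   ≡⟨ cong (κ ℚ.*_) lead≡0 ⟩
    κ ℚ.* 0ℚ                                         ≡⟨ ℚP.*-zeroʳ κ ⟩
    0ℚ ∎)
    where
    open ≡-Reasoning
    κ : ℚ
    κ = Approximation₁.κ
    first-error-lead≢0 : coeff ((zL +L oneL) *L fTM -L oneL) (-[1+ 1 ]) ≢ 0ℚ
    first-error-lead≢0 ()

  fTM*y₁≋ : fTM *L fracPart 1 ≋ -L err 2
  fTM*y₁≋ = begin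
    fTM *L fracPart 1                ≈⟨ LR.*-cong (LR.sym err₁≋g) (LR.refl {fracPart 1}) ⟩
    err 1 *L fracPart 1              ≈⟨ solve 1 (λ X → X := :- (:- X)) LR.refl (err 1 *L fracPart 1) ⟩
    -L (-L (err 1 *L fracPart 1))    ≈⟨ LR.-‿cong (LR.sym (err-next 0)) ⟩
    -L err 2 ∎
    where open ≋-Reasoning

  module Quotient₂ = Quotient (fracPart 1) fTM (-L err 2) (-[1+ 0 ]) (-[1+ 1 ]) (un fTM*y₁≋) Deg≤-fTM fTM-lead≢0
                              (Deg≤-neg (err 2) (-[1+ 1 ]) (Deg≤-err 1))

  y₁-lead≢0 : coeff (fracPart 1) (-[1+ 0 ]) ≢ 0ℚ
  y₁-lead≢0 lead≡0 = err₂-lead≢0 (ℚP.neg-injective (begin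
    ℚ.- coeff (err 2) (-[1+ 1 ])                           ≡⟨ sym (coeff-neg (err 2) (-[1+ 1 ])) ⟩
    coeff (-L err 2) (-[1+ 1 ])                            ≡⟨ sym Quotient₂.coeff-quotient ⟩
    coeff fTM (-[1+ 0 ]) ℚ.* coeff (fracPart 1) (-[1+ 0 ]) ≡⟨ cong (coeff fTM (-[1+ 0 ]) ℚ.*_) lead≡0 ⟩
    coeff fTM (-[1+ 0 ]) ℚ.* 0ℚ                            ≡⟨ ℚP.*-zeroʳ (coeff fTM (-[1+ 0 ])) ⟩
    0ℚ ∎))
    where open ≡-Reasoning

  module Quotient₃ = Quotient (x c 2) (fracPart 1) oneL (-[1+ 0 ]) (+ 0) (step c 1) Quotient₂.Deg≤-quotient y₁-lead≢0 (Deg≤-const 1ℚ)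

  Deg≤-Q₂ : Deg≤ (Q c 2) (+ 2)
  Deg≤-Q₂ = Deg≤-add (a c 2 *L Q c 1) oneL (+ 2) (Deg≤-mul (a c 2) (Q c 1) (+ 1) (+ 1) (Deg≤-a 2 Quotient₃.Deg≤-quotient) Deg≤-Q₁)
      (Deg≤-constL 1ℚ 2)

  Deg≤-z²+1 : Deg≤ (zL *L zL +L oneL) (+ 2)
  Deg≤-z²+1 = Deg≤-add (zL *L zL) oneL (+ 2) (Deg≤-mul zL zL (+ 1) (+ 1) Deg≤-z Deg≤-z) (Deg≤-constL 1ℚ 2)

  Deg≤-z-1 : Deg≤ (zL -L oneL) (+ 1)
  Deg≤-z-1 = Deg≤-sub zL oneL (+ 1) Deg≤-z (Deg≤-constL 1ℚ 1)

  second-error-deg : Deg≤ ((zL *L zL +L oneL) *L fTM -L (zL -L oneL)) (-[1+ 2 ])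
  second-error-deg = Deg≤-pred E (-[1+ 2 ]) (Deg≤-pred E (-[1+ 1 ]) (Deg≤-pred E (-[1+ 0 ]) (Deg≤-pred E (+ 0) deg₁ refl) refl) refl) refl
    where
    E : Laurent
    E = (zL *L zL +L oneL) *L fTM -L (zL -L oneL)
    deg₁ : Deg≤ E (+ 1)
    deg₁ = Deg≤-sub ((zL *L zL +L oneL) *L fTM) (zL -L oneL) (+ 1)
        (Deg≤-mul (zL *L zL +L oneL) fTM (+ 2) (-[1+ 0 ]) Deg≤-z²+1 Deg≤-fTM) Deg≤-z-1

  module Approximation₂ = BestApproximation 1 (zL *L zL +L oneL) (zL -L oneL)
    (IsPoly-add (zL *L zL) oneL (IsPoly-mul zL zL IsPoly-z IsPoly-z) (IsPoly-const 1ℚ))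
    (IsPoly-add zL (-L oneL) IsPoly-z (IsPoly-neg oneL (IsPoly-const 1ℚ)))
    Deg≤-z²+1 second-error-deg Deg≤-Q₂ Deg≤-Q₁

  P̂Q̂₂ : (P̂ c 2 ≋ zL -L oneL) × (Q̂ c 2 ≋ zL *L zL +L oneL)
  P̂Q̂₂ = normalised-convergent 2 Approximation₂.κ 1 Approximation₂.Px≋κP Approximation₂.Qx≋κQ (Deg≤-z-1 , refl)

  Q̂-recurrence : ∀ j → 2 ≤ j → ∀ {s} → negOnePow j ≡ s →
                 Q̂ c (suc j) ≋ (zL +L constL s) *L Q̂ c j +L constL (β (suc j)) *L Q̂ c (j ℕ.∸ 1)
  Q̂-recurrence j 2≤j refl = LR.trans ⟪ proj₁ (hyp j 2≤j) ⟫
    (LR.+-cong (LR.refl {(zL +L constL (negOnePow j)) *L Q̂ c j}) (scale≈constL-* (β (suc j)) (Q̂ c (j ℕ.∸ 1))))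

  P̂-recurrence : ∀ j → 2 ≤ j →
                 P̂ c (suc j) ≋ (zL +L constL (negOnePow j)) *L P̂ c j +L constL (β (suc j)) *L P̂ c (j ℕ.∸ 1)
  P̂-recurrence j 2≤j = LR.trans ⟪ proj₂ (hyp j 2≤j) ⟫
    (LR.+-cong (LR.refl {(zL +L constL (negOnePow j)) *L P̂ c j}) (scale≈constL-* (β (suc j)) (P̂ c (j ℕ.∸ 1))))

  MonicPair : ℕ → Set
  MonicPair n = (Monic (P̂ c (1 + n)) n × Monic (Q̂ c (1 + n)) (1 + n)) × (Monic (P̂ c (2 + n)) (1 + n) × Monic (Q̂ c (2 + n)) (2 + n))

  monic-pair-step : ∀ n → MonicPair n → MonicPair (suc n)
  monic-pair-step n ((P̂₁-monic , Q̂₁-monic) , (P̂₂-monic , Q̂₂-monic)) = (P̂₂-monic , Q̂₂-monic) ,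
    (Monic-≋ (2 + n) (LR.sym (P̂-recurrence (2 + n) (s≤s (s≤s z≤n))))
       (Monic-recurrence (negOnePow (2 + n)) (β (3 + n)) (P̂ c (2 + n)) (P̂ c (1 + n)) (1 + n) P̂₂-monic
         (Deg≤-mono {P̂ c (1 + n)} (proj₁ P̂₁-monic) (ℤ.+≤+ (ℕP.n≤1+n n)))) ,
     Monic-≋ (3 + n) (LR.sym (Q̂-recurrence (2 + n) (s≤s (s≤s z≤n)) refl))
       (Monic-recurrence (negOnePow (2 + n)) (β (3 + n)) (Q̂ c (2 + n)) (Q̂ c (1 + n)) (2 + n) Q̂₂-monic
         (Deg≤-mono {Q̂ c (1 + n)} (proj₁ Q̂₁-monic) (ℤ.+≤+ (ℕP.n≤1+n (1 + n))))))

  monic-pairs : ∀ n → MonicPair n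
  monic-pairs zero =
    (Monic-≋ 0 (LR.sym (proj₁ P̂Q̂₁)) (Deg≤-const 1ℚ , refl) , Monic-≋ 1 (LR.sym (proj₂ P̂Q̂₁)) (Deg≤-z+const 1ℚ , refl)) ,
    (Monic-≋ 1 (LR.sym (proj₁ P̂Q̂₂)) (Deg≤-z-1 , refl) , Monic-≋ 2 (LR.sym (proj₂ P̂Q̂₂)) (Deg≤-z²+1 , refl))
  monic-pairs (suc n) = monic-pair-step n (monic-pairs n)

  P̂-monic : ∀ n → Monic (P̂ c (suc n)) n
  P̂-monic n = proj₁ (proj₁ (monic-pairs n))

  Q̂-monic : ∀ n → Monic (Q̂ c (suc n)) (suc n)
  Q̂-monic n = proj₂ (proj₁ (monic-pairs n))

  invρ-nonzero : ∀ n → invQ (ρ c (suc n)) ≢ 0ℚ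
  invρ-nonzero n = *≡1⇒nonzeroˡ (invQ (ρ c (suc n))) (coeff (P c (suc n)) (+ n))
                     (trans (sym (coeff-scale (invQ (ρ c (suc n))) (P c (suc n)) (+ n))) (proj₂ (P̂-monic n)))

  Deg≤-Q : ∀ n → Deg≤ (Q c n) (+ n)
  Deg≤-Q zero = Deg≤-const 1ℚ
  Deg≤-Q (suc n) j n<j = *-zero-cancelˡ (invQ (ρ c (suc n))) (coeff (Q c (suc n)) j) (invρ-nonzero n)
                           (trans (sym (coeff-scale (invQ (ρ c (suc n))) (Q c (suc n)) j)) (proj₁ (Q̂-monic n) j n<j))

  Q̂-double : ∀ k {i} → i ≡ suc k ℕ.+ suc k → Q̂ c i ≋ atZ² (Q̂ c (suc k))
  Q̂-double k refl = proj₂ (normalised-convergent (K ℕ.+ K) (r ℚ.* κ) (suc (k ℕ.+ k)) X≋ Y≋ X-monic)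
    where
    K m : ℕ
    K = suc k
    m = k ℕ.+ suc k
    Z₋ Qx Px X Y : Laurent
    Z₋ = zL -L oneL
    Qx = atZ² (Q c K)
    Px = Z₋ *L atZ² (P c K)
    X = Z₋ *L atZ² (P̂ c K)
    Y = atZ² (Q̂ c K)
    r : ℚ
    r = invQ (ρ c K)

    error≋ : Qx *L fTM -L Px ≋ Z₋ *L atZ² (err (suc K))
    error≋ = begin
      Qx *L fTM -L Px
        ≈⟨ LR.+-cong (LR.*-cong (LR.refl {Qx}) fTM-functional-equation) (LR.refl { -L Px}) ⟩
      Qx *L (Z₋ *L atZ² fTM) -L Z₋ *L atZ² (P c K)
        ≈⟨ solve 4 (λ Qx F P Z → Qx :* (Z :* F) :- Z :* P := Z :* (Qx :* F :- P)) LR.refl Qx (atZ² fTM) (atZ² (P c K)) Z₋ ⟩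
      Z₋ *L (Qx *L atZ² fTM -L atZ² (P c K))
        ≈⟨ LR.*-cong (LR.refl {Z₋})
            (LR.sym (LR.trans (atZ²-add (Q c K *L fTM) (-L P c K)) (LR.+-cong (atZ²-mul (Q c K) fTM) (atZ²-neg (P c K))))) ⟩
      Z₋ *L atZ² (err (suc K)) ∎
      where open ≋-Reasoning

    error-deg : Deg≤ (Qx *L fTM -L Px) (-[1+ suc m ])
    error-deg = Deg≤-≈ (Z₋ *L atZ² (err (suc K))) (Qx *L fTM -L Px) (-[1+ suc m ]) (un (LR.sym error≋))
      (Deg≤-mono {Z₋ *L atZ² (err (suc K))}
          (Deg≤-mul Z₋ (atZ² (err (suc K))) (+ 1) (-[1+ K ] +ᶻ -[1+ K ]) Deg≤-z-1 (Deg≤-atZ² (err (suc K)) (-[1+ K ]) (Deg≤-err K)))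
        (ℤP.≤-reflexive (lem (+ K))))
      where lem : ∀ K → + 1 +ᶻ (-ᶻ (+ 1 +ᶻ K) +ᶻ -ᶻ (+ 1 +ᶻ K)) ≡ -ᶻ (+ 1 +ᶻ (K +ᶻ K))
            lem = zsolve-∀

    module Approximation = BestApproximation m Qx Px (IsPoly-atZ² (Q c K) (Qm-IsPoly (suc K)))
      (IsPoly-mul Z₋ (atZ² (P c K)) (IsPoly-add zL (-L oneL) IsPoly-z (IsPoly-neg oneL (IsPoly-const 1ℚ)))
          (IsPoly-atZ² (P c K) (Pm-IsPoly (suc K))))
      (Deg≤-atZ² (Q c K) (+ K) (Deg≤-Q K)) error-deg (Deg≤-Q (suc m)) (Deg≤-Q m)
    κ : ℚ
    κ = Approximation.κ

    X≋ : X ≋ constL (r ℚ.* κ) *L P c (K ℕ.+ K)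
    X≋ = begin
      Z₋ *L atZ² (P̂ c K)                        ≈⟨ LR.*-cong (LR.refl {Z₋})
          (LR.trans (atZ²-scale r (P c K)) (scale≈constL-* r (atZ² (P c K)))) ⟩
      Z₋ *L (constL r *L atZ² (P c K))          ≈⟨ solve 3 (λ Z R P → Z :* (R :* P) := R :* (Z :* P)) LR.refl Z₋ (constL r) (atZ² (P c K)) ⟩
      constL r *L Px                            ≈⟨ LR.*-cong (LR.refl {constL r}) Approximation.Px≋κP ⟩
      constL r *L (constL κ *L P c (K ℕ.+ K))   ≈⟨ LR.sym (LR.*-assoc (constL r) (constL κ) (P c (K ℕ.+ K))) ⟩
      (constL r *L constL κ) *L P c (K ℕ.+ K)   ≈⟨ LR.*-cong (LR.sym (constL-* r κ)) (LR.refl {P c (K ℕ.+ K)}) ⟩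
      constL (r ℚ.* κ) *L P c (K ℕ.+ K) ∎
      where open ≋-Reasoning

    Y≋ : Y ≋ constL (r ℚ.* κ) *L Q c (K ℕ.+ K)
    Y≋ = begin
      atZ² (Q̂ c K)                              ≈⟨ LR.trans (atZ²-scale r (Q c K)) (scale≈constL-* r Qx) ⟩
      constL r *L Qx                            ≈⟨ LR.*-cong (LR.refl {constL r}) Approximation.Qx≋κQ ⟩
      constL r *L (constL κ *L Q c (K ℕ.+ K))   ≈⟨ LR.sym (LR.*-assoc (constL r) (constL κ) (Q c (K ℕ.+ K))) ⟩
      (constL r *L constL κ) *L Q c (K ℕ.+ K)   ≈⟨ LR.*-cong (LR.sym (constL-* r κ)) (LR.refl {Q c (K ℕ.+ K)}) ⟩
      constL (r ℚ.* κ) *L Q c (K ℕ.+ K) ∎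
      where open ≋-Reasoning

    X-monic : Monic X (suc (k ℕ.+ k))
    X-monic = Deg≤-mul Z₋ (atZ² (P̂ c K)) (+ 1) (+ k +ᶻ + k) Deg≤-z-1 (Deg≤-atZ² (P̂ c K) (+ k) (proj₁ (P̂-monic k))) ,
              trans (coeff-mul-top Z₋ (atZ² (P̂ c K)) (+ 1) (+ k +ᶻ + k) Deg≤-z-1 (Deg≤-atZ² (P̂ c K) (+ k) (proj₁ (P̂-monic k))))
                (cong (coeff Z₋ (+ 1) ℚ.*_) (trans (coeff-atZ²-even (P̂ c K) (+ k)) (proj₂ (P̂-monic k))))

  Q̂-double-recurrence : ∀ k s b X Y {X′ Y′} → Q̂ c (suc k) ≋ (zL +L constL s) *L X +L constL b *L Y →
                        atZ² X ≋ X′ → atZ² Y ≋ Y′ → ∀ {i} → i ≡ suc k ℕ.+ suc k →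
                        Q̂ c i ≋ (zL *L zL +L constL s) *L X′ +L constL b *L Y′
  Q̂-double-recurrence k s b X Y {X′} {Y′} rec X≋ Y≋ {i} i≡ = begin
    Q̂ c i                                                   ≈⟨ Q̂-double k i≡ ⟩
    atZ² (Q̂ c (suc k))                                      ≈⟨ atZ²-cong _ _ rec ⟩
    atZ² ((zL +L constL s) *L X +L constL b *L Y)           ≈⟨ atZ²-recurrence s b X Y ⟩
    (zL *L zL +L constL s) *L atZ² X +L constL b *L atZ² Y
      ≈⟨ LR.+-cong (LR.*-cong (LR.refl {zL *L zL +L constL s}) X≋) (LR.*-cong (LR.refl {constL b}) Y≋) ⟩
    (zL *L zL +L constL s) *L X′ +L constL b *L Y′ ∎
    where open ≋-Reasoning

  β₃-β₄ : (β 3 ≡ ℚ.- 1ℚ) × (β 4 ≡ 1ℚ)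
  β₃-β₄ = β₃≡-1 , trans β₄≡ (cong (λ b → (1ℚ ℚ.+ ℚ.- 1ℚ) ℚ.- b) β₃≡-1)
    where
    two : ℚ
    two = 1ℚ ℚ.+ 1ℚ
    Q̂₂-recurrence : Q̂ c 2 ≋ (zL +L constL (ℚ.- 1ℚ)) *L Q̂ c 1 +L constL two *L oneL
    Q̂₂-recurrence = begin
      Q̂ c 2                   ≈⟨ proj₂ P̂Q̂₂ ⟩
      zL *L zL +L oneL        ≈⟨ solve 1 (λ Z → Z :* Z :+ con 1ℚ := (Z :+ con (ℚ.- 1ℚ)) :* (Z :+ con 1ℚ) :+ con two :* con 1ℚ) LR.refl zL ⟩
      (zL +L constL (ℚ.- 1ℚ)) *L (zL +L oneL) +L constL two *L oneL
        ≈⟨ LR.+-cong (LR.*-cong (LR.refl {zL +L constL (ℚ.- 1ℚ)}) (LR.sym (proj₂ P̂Q̂₁))) (LR.refl {constL two *L oneL}) ⟩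
      (zL +L constL (ℚ.- 1ℚ)) *L Q̂ c 1 +L constL two *L oneL ∎
      where open ≋-Reasoning
    relations : (β 4 ≡ (1ℚ ℚ.+ ℚ.- 1ℚ) ℚ.- β 3) × (β 3 ℚ.* two ≡ ℚ.- two)
    relations = doubling-relations {Q̂ c 1} {Q̂ c 2} {oneL} {Q̂ c 3} {Q̂ c 4} two (β 3) (β 4) two (ℚ.- 1ℚ)
      (Q̂-monic 1) (Deg≤-const 1ℚ , refl)
      Q̂₂-recurrence (Q̂-recurrence 2 (s≤s (s≤s z≤n)) refl) (Q̂-recurrence 3 (s≤s (s≤s z≤n)) refl)
      (Q̂-double-recurrence 1 (ℚ.- 1ℚ) two (Q̂ c 1) oneL Q̂₂-recurrence (LR.sym (Q̂-double 0 refl)) (atZ²-const 1ℚ) refl)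
    β₄≡ : β 4 ≡ (1ℚ ℚ.+ ℚ.- 1ℚ) ℚ.- β 3
    β₄≡ = proj₁ relations
    β₃≡-1 : β 3 ≡ ℚ.- 1ℚ
    β₃≡-1 = *-cancelʳ-≢0 two (λ ()) (proj₂ relations)

  β-doubling : ∀ t → let m = t ℕ.+ suc t in
               (β (4 + m) ℚ.* β (3 + m) ≡ ℚ.- β (3 + t)) × (β (5 + m) ≡ (1ℚ ℚ.+ negOnePow (2 + t)) ℚ.- β (4 + m))
  β-doubling t = Data.Product.swap (doubling-relations {Q̂ c (2 + m)} {Q̂ c (3 + m)} {Q̂ c (1 + m)} {Q̂ c (4 + m)} {Q̂ c (5 + m)}
      (β (3 + m)) (β (4 + m)) (β (5 + m)) (β (3 + t)) (negOnePow (2 + t))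
      (Q̂-monic (2 + m)) (Q̂-monic m)
      (Q̂-recurrence (2 + m) 2≤ sign₂) (Q̂-recurrence (3 + m) 2≤ sign₃) (Q̂-recurrence (4 + m) 2≤ (cong ℚ.-_ sign₃))
      (Q̂-double-recurrence (2 + t) (negOnePow (2 + t)) (β (3 + t)) (Q̂ c (2 + t)) (Q̂ c (1 + t)) (Q̂-recurrence (2 + t) 2≤ refl)
        (LR.sym (Q̂-double (suc t) (index₃ t))) (LR.sym (Q̂-double t refl)) (index₅ t)))
    where
    m : ℕ
    m = t ℕ.+ suc t
    2≤ : ∀ {j} → 2 ≤ 2 + j
    2≤ = s≤s (s≤s z≤n)
    sign₂ : negOnePow (2 + m) ≡ ℚ.- 1ℚ
    sign₂ = cong ℚ.-_ (negOnePow-even (suc t))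
    sign₃ : negOnePow (3 + m) ≡ 1ℚ
    sign₃ = trans (-‿involutive _) (negOnePow-even (suc t))
    index₃ : ∀ t → 3 + (t ℕ.+ suc t) ≡ suc (suc t) ℕ.+ suc (suc t)
    index₃ = nsolve-∀
    index₅ : ∀ t → 5 + (t ℕ.+ suc t) ≡ suc (suc (suc t)) ℕ.+ suc (suc (suc t))
    index₅ = nsolve-∀

  P̂Q̂-determinant : ∀ n → P̂ c (suc n) *L Q̂ c n -L P̂ c n *L Q̂ c (suc n)
                         ≋ constL ((invQ (ρ c (suc n)) ℚ.* invQ (ρ c n)) ℚ.* negOnePow (suc (suc n)))
  P̂Q̂-determinant n = begin
    P̂ c (suc n) *L Q̂ c n -L P̂ c n *L Q̂ c (suc n)
      ≈⟨ LR.+-cong (LR.*-cong (scale≈constL-* r₁ (P c (suc n))) (scale≈constL-* r₀ (Q c n)))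
                   (LR.-‿cong (LR.*-cong (scale≈constL-* r₀ (P c n)) (scale≈constL-* r₁ (Q c (suc n))))) ⟩
    (constL r₁ *L P c (suc n)) *L (constL r₀ *L Q c n) -L (constL r₀ *L P c n) *L (constL r₁ *L Q c (suc n))
      ≈⟨ solve 6 (λ c₁ c₀ P₁ P₀ Q₁ Q₀ → (c₁ :* P₁) :* (c₀ :* Q₀) :- (c₀ :* P₀) :* (c₁ :* Q₁)
                                        := (c₁ :* c₀) :* (P₁ :* Q₀ :- P₀ :* Q₁))
                 LR.refl (constL r₁) (constL r₀) (P c (suc n)) (P c n) (Q c (suc n)) (Q c n) ⟩
    (constL r₁ *L constL r₀) *L (P c (suc n) *L Q c n -L P c n *L Q c (suc n))
      ≈⟨ LR.*-cong (LR.sym (constL-* r₁ r₀)) (det≋ (suc n)) ⟩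
    constL (r₁ ℚ.* r₀) *L constL (negOnePow (suc (suc n)))
      ≈⟨ LR.sym (constL-* (r₁ ℚ.* r₀) (negOnePow (suc (suc n)))) ⟩
    constL ((r₁ ℚ.* r₀) ℚ.* negOnePow (suc (suc n))) ∎
    where
    open ≋-Reasoning
    r₁ r₀ : ℚ
    r₁ = invQ (ρ c (suc n))
    r₀ = invQ (ρ c n)

  -- If β_{M+1} vanished, P̂_{M+1} and Q̂_{M+1} would be the same multiple of
  -- P̂_M and Q̂_M, killing the determinant.
  β-nonzero : ∀ m → β (3 + m) ≢ 0ℚ
  β-nonzero m β≡0 = *-nonzero (r₁ ℚ.* r₀) (negOnePow (2 + M)) (*-nonzero r₁ r₀ (invρ-nonzero (2 + m)) (invρ-nonzero (1 + m)))
                      (negOnePow-nonzero (2 + M)) (constL-injective determinant≋0)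
    where
    M : ℕ
    M = 2 + m
    2≤M : 2 ≤ M
    2≤M = s≤s (s≤s z≤n)
    r₁ r₀ : ℚ
    r₁ = invQ (ρ c (suc M))
    r₀ = invQ (ρ c M)
    Zₘ : Laurent
    Zₘ = zL +L constL (negOnePow M)
    without-β : ∀ X′ X Y → X′ ≋ Zₘ *L X +L constL (β (suc M)) *L Y → X′ ≋ Zₘ *L X +L constL 0ℚ *L Y
    without-β X′ X Y rec = LR.trans rec (LR.reflexive (cong (λ b → Zₘ *L X +L constL b *L Y) β≡0))
    determinant≋0 : constL ((r₁ ℚ.* r₀) ℚ.* negOnePow (suc (suc M))) ≋ constL 0ℚ
    determinant≋0 = begin
      constL ((r₁ ℚ.* r₀) ℚ.* negOnePow (suc (suc M)))
        ≈⟨ LR.sym (P̂Q̂-determinant M) ⟩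
      P̂ c (suc M) *L Q̂ c M -L P̂ c M *L Q̂ c (suc M)
        ≈⟨ LR.+-cong (LR.*-cong (without-β (P̂ c (suc M)) (P̂ c M) (P̂ c (suc m)) (P̂-recurrence M 2≤M)) (LR.refl {Q̂ c M}))
                     (LR.-‿cong
                         (LR.*-cong (LR.refl {P̂ c M}) (without-β (Q̂ c (suc M)) (Q̂ c M) (Q̂ c (suc m)) (Q̂-recurrence M 2≤M refl)))) ⟩
      (Zₘ *L P̂ c M +L constL 0ℚ *L P̂ c (suc m)) *L Q̂ c M -L P̂ c M *L (Zₘ *L Q̂ c M +L constL 0ℚ *L Q̂ c (suc m))
        ≈⟨ solve 5 (λ Z P₀ P′ Q₀ Q′ → (Z :* P₀ :+ con 0ℚ :* P′) :* Q₀ :- P₀ :* (Z :* Q₀ :+ con 0ℚ :* Q′) := con 0ℚ)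
                   LR.refl Zₘ (P̂ c M) (P̂ c (suc m)) (Q̂ c M) (Q̂ c (suc m)) ⟩
      constL 0ℚ ∎
      where open ≋-Reasoning

  private
    index₂ : ∀ t → 2 * suc (suc t) + 2 ≡ 5 + (t ℕ.+ suc t)
    index₂ = nsolve-∀
    index₁ : ∀ t → 2 * suc (suc t) + 1 ≡ 4 + (t ℕ.+ suc t)
    index₁ = nsolve-∀
    index₀ : ∀ t → 2 * suc (suc t) ≡ 3 + (t ℕ.+ suc t)
    index₀ = nsolve-∀
    index-half : ∀ t → suc (suc t) + 1 ≡ 3 + t
    index-half = nsolve-∀

  β-doubling-relations : ∀ n → 2 ≤ n →
    (β (2 * n) ≢ 0ℚ) × (β (2 * n + 1) ℚ.* β (2 * n) ≡ ℚ.- β (n + 1))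
                     × (β (2 * n + 2) ≡ (1ℚ ℚ.+ negOnePow n) ℚ.- β (2 * n + 1))
  β-doubling-relations (suc (suc t)) (s≤s (s≤s z≤n))
    rewrite index₂ t | index₁ t | index₀ t | index-half t
    = β-nonzero (t ℕ.+ suc t) , β-doubling t

proposition3 : (c : CFExpansion fTM) (β : ℕ → ℚ) → DefinesBeta c β →
    (β 3 ≡ ℚ.- 1ℚ) × (β 4 ≡ 1ℚ) ×
    (∀ n → 2 ≤ n →
    Σ (NonZero (β (2 * n))) (λ nz → β (2 * n + 1) ≡ ℚ.- ((β (n + 1) ÷ β (2 * n)) {{nz}}))
    × (β (2 * n + 2) ≡ (1ℚ ℚ.+ negOnePow n) ℚ.- β (2 * n + 1)))
proposition3 c β hyp = proj₁ β₃-β₄ , proj₂ β₃-β₄ , λ n 2≤n →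
  let (β₂ₙ≢0 , odd-relation , even-relation) = β-doubling-relations n 2≤n
      nz : NonZero (β (2 * n))
      nz = ≢-nonZero β₂ₙ≢0
  in (nz , *≡-⇒≡-÷ nz odd-relation) , even-relation
  where open ThueMorseExpansion c β hyp
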